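{- Let $q\ge5$ be a prime power. No $\Gamma$-plane, $0_{\mathcal C}$-plane, $2_{\mathcal C}$-plane or $3_{\mathcal C}$-plane contains an imaginary chord of $\mathcal C$. All $q+1$ planes through an imaginary chord are $\overline{1_{\mathcal C}}$-planes (forming a pencil), and every $\overline{1_{\mathcal C}}$-plane contains exactly one imaginary chord. Consequently, the set of all $\overline{1_{\mathcal C}}$-planes, which has size $\binom{q}{2}(q+1)$, is partitioned into $\binom{q}{2}$ pencils of planes, each having an imaginary chord as axis.
   Context: Let $\mathrm{PG}(3,q)$ have points $\mathbf{P}(x_0,x_1,x_2,x_3)$; put $P(t)=\mathbf{P}(t^3,t^2,t,1)$ ($t\in\mathbb{F}_q$), $P(\infty)=\mathbf{P}(1,0,0,0)$, and let $\mathcal{C}=\{P(t):t\in\mathbb{F}_q\cup\{\infty\}\}$ be the twisted cubic. Write $\boldsymbol{\pi}(c_0,c_1,c_2,c_3)$ for the plane $c_0x_0+c_1x_1+c_2x_2+c_3x_3=0$. The osculating plane at $P(t)$ is $\boldsymbol{\pi}(1,-3t,3t^2,-t^3)$ ($t\in\mathbb{F}_q$) and $\boldsymbol{\pi}(0,0,0,1)$ ($t=\infty$); these are the $\Gamma$-planes. A $d_{\mathcal C}$-plane ($d\in\{0,2,3\}$) contains exactly $d$ points of $\mathcal C$; a $\overline{1_{\mathcal C}}$-plane is a plane that is not a $\Gamma$-plane and contains exactly one point of $\mathcal C$. An imaginary chord is the line of $\mathrm{PG}(3,q)$ joining the conjugate points $P(s)$ and $P(s^q)$ for $s\in\mathbb{F}_{q^2}\setminus\mathbb{F}_q$;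 there are $\binom q2$ imaginary chords. -}

module Defs where

open import Data.Nat using (ℕ; zero; suc; _≤_; _^_) renaming (_*_ to _*ℕ_)
open import Data.Nat.Primality using (Prime)
open import Data.Maybe using (Maybe; just; nothing)
open import Data.List using (List; length)
open import Data.List.Membership.Propositional using (_∈_)
open import Data.List.Relation.Unary.All using (All)
open import Data.List.Relation.Unary.Unique.Propositional using (Unique)
open import Data.Product using (Σ; ∃; ∃-syntax; _×_; _,_)
open import Data.Sum using (_⊎_)
open import Relation.Nullary using (¬_)
open import Relation.Binary.PropositionalEquality using (_≡_; _≢_)
open import Relation.Binary.Definitions using (DecidableEquality)
open import Algebra.Structures using (IsCommutativeRing)
open import Function.Bundles using (_⇔_)
open import Data.Unit using (⊤)

IsPrimePower : ℕ → Set
IsPrimePower q = ∃[ p ] ∃[ k ] (Prime p × 1 ≤ k × q ≡ p ^ k)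

HasSize : (A : Set) → (A → Set) → ℕ → Set
HasSize A P n =
  Σ (List A) λ xs → Unique xs × All P xs × (∀ x → P x → x ∈ xs) × length xs ≡ n

record FiniteField (q : ℕ) : Set₁ where
  infixl 6 _+_
  infixl 7 _*_
  field
    Carrier : Set
    _+_ _*_ : Carrier → Carrier → Carrier
    -_ : Carrier → Carrier
    0# 1# : Carrier
    isCommutativeRing : IsCommutativeRing _≡_ _+_ _*_ -_ 0# 1#
    0≢1 : 0# ≢ 1#
    inverse : ∀ x → x ≢ 0# → ∃[ y ] (x * y ≡ 1#)
    _≟_ : DecidableEquality Carrier
    card : HasSize Carrier (λ _ → ⊤) q

  pow : Carrier → ℕ → Carrier
  pow x zero = 1#
  pow x (suc n) = x * pow x n

  3# : Carrier
  3# = 1# + 1# + 1#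

record Embedding {q r : ℕ} (F : FiniteField q) (K : FiniteField r) : Set where
  private
    module F = FiniteField F
    module K = FiniteField K
  field
    ι : F.Carrier → K.Carrier
    ι-+ : ∀ x y → ι (x F.+ y) ≡ ι x K.+ ι y
    ι-* : ∀ x y → ι (x F.* y) ≡ ι x K.* ι y
    ι-1 : ι F.1# ≡ K.1#

-- Homogeneous 4-tuples (coordinates of points / coefficients of planes)

record V4 (A : Set) : Set where
  constructor ⟨_,_,_,_⟩
  field
    c0 c1 c2 c3 : A

map4 : {A B : Set} → (A → B) → V4 A → V4 B
map4 f ⟨ a , b , c , d ⟩ = ⟨ f a , f b , f c , f d ⟩

module TwistedCubic {q : ℕ} (F : FiniteField q) (K : FiniteField (q *ℕ q))
                    (E : Embedding F K) where
  open FiniteField F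
  module K = FiniteField K
  open Embedding E

  Vec4 : Set
  Vec4 = V4 Carrier

  -- canonical representative of a projective point / plane:
  -- first nonzero coordinate equals 1
  Normalized : Vec4 → Set
  Normalized ⟨ a , b , c , d ⟩ =
       (a ≡ 1#)
     ⊎ (a ≡ 0# × b ≡ 1#)
     ⊎ (a ≡ 0# × b ≡ 0# × c ≡ 1#)
     ⊎ (a ≡ 0# × b ≡ 0# × c ≡ 0# × d ≡ 1#)

  _·_ : Vec4 → Vec4 → Carrier
  ⟨ a , b , c , d ⟩ · ⟨ x , y , z , w ⟩ = a * x + b * y + c * z + d * w

  _∈π_ : Vec4 → Vec4 → Set
  X ∈π π = π · X ≡ 0#

  scale : Carrier → Vec4 → Vec4
  scale c = map4 (c *_)

  Proportional : Vec4 → Vec4 → Set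
  Proportional u v = ∃[ c ] (c ≢ 0# × u ≡ scale c v)

  -- points of the twisted cubic; nothing = ∞
  P : Maybe Carrier → Vec4
  P (just t) = ⟨ pow t 3 , pow t 2 , t , 1# ⟩
  P nothing  = ⟨ 1# , 0# , 0# , 0# ⟩

  osc : Maybe Carrier → Vec4
  osc (just t) = ⟨ 1# , - (3# * t) , 3# * pow t 2 , - pow t 3 ⟩
  osc nothing  = ⟨ 0# , 0# , 0# , 1# ⟩

  ΓPlane : Vec4 → Set
  ΓPlane π = ∃[ t ] Proportional π (osc t)

  PlaneMeetsC : Vec4 → ℕ → Set
  PlaneMeetsC π d = HasSize (Maybe Carrier) (λ t → P t ∈π π) d

  Bar1Plane : Vec4 → Set
  Bar1Plane π = ¬ ΓPlane π × PlaneMeetsC π 1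

  Imaginary : K.Carrier → Set
  Imaginary s = ¬ (∃[ a ] ι a ≡ s)

  PK : K.Carrier → V4 K.Carrier
  PK t = ⟨ K.pow t 3 , K.pow t 2 , t , K.1# ⟩

  _+K4_ : V4 K.Carrier → V4 K.Carrier → V4 K.Carrier
  ⟨ a , b , c , d ⟩ +K4 ⟨ x , y , z , w ⟩ = ⟨ a K.+ x , b K.+ y , c K.+ z , d K.+ w ⟩

  scaleK : K.Carrier → V4 K.Carrier → V4 K.Carrier
  scaleK c = map4 (c K.*_)

  OnChord : K.Carrier → Vec4 → Set
  OnChord s X = ∃[ a ] ∃[ b ]
    (map4 ι X ≡ scaleK a (PK s) +K4 scaleK b (PK (K.pow s q)))

  ContainsChord : Vec4 → K.Carrier → Set
  ContainsChord π s = ∀ X → Normalized X → OnChord s X → X ∈π π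

  SameChord : K.Carrier → K.Carrier → Set
  SameChord s t = ∀ X → Normalized X → (OnChord s X ⇔ OnChord t X)

-- Conjugation x ↦ x^q is an automorphism of F_{q²} with fixed field F_q, so for imaginary s the
-- chord through P(s) and P(s^q) is defined over F_q, and a plane π(c₀,c₁,c₂,c₃) contains it exactly when its cubic
-- c₀t³ + c₁t² + c₂t + c₃ vanishes at s, i.e. when the minimal polynomial (t - s)(t - s^q) of s divides it.
-- The planes through the chord thus have cubics (t - s)(t - s^q)(at + b), (a : b) ∈ PG(1,q): a pencil of q + 1
-- planes, each meeting C only in P(-b/a) and none osculating, as osculating cubics are constants or cubes (t - v)³.
-- Conversely the cubic of a plane meeting C exactly once has an irreducible quadratic factor over F_q, and counting
-- (q(q+1)/2 reducible monic quadratics, C(q,2) chords, q² quadratics in all) shows that it is the minimal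
-- polynomial of one of the C(q,2) imaginary chords; so their pencils are disjoint and cover these planes.

module Submission where

open import Defs
open import Algebra.Bundles using (CommutativeRing; CommutativeMonoid; Ring)
open import Algebra.Solver.Ring.AlmostCommutativeRing using (_-Raw-AlmostCommutative⟶_; fromCommutativeRing)
open import Data.Empty using (⊥; ⊥-elim)
open import Data.Fin as Fin using (Fin; toℕ; inject₁)
import Data.Fin.Properties as Fin
open import Data.Integer as ℤ using (ℤ; -[1+_]; _⊖_)
import Data.Integer.Properties as ℤ
open import Data.List using (List; []; _∷_; length; map; filter; foldr; _++_; cartesianProduct; concatMap)
open import Data.List.Properties
  using (length-filter; filter-all; filter-accept; filter-reject; length-++; length-map; map-++; map-∘)
open import Data.List.Membership.Propositional using (_∈_; _∉_; find; lose)
open import Data.List.Membership.Propositional.Properties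
  using (∈-map⁺; ∈-map⁻; ∈-filter⁺; ∈-filter⁻; ∈-++⁺ˡ; ∈-++⁺ʳ; ∈-++⁻; ∈-cartesianProduct⁺; ∈-concatMap⁺; ∈-concatMap⁻)
open import Data.List.Membership.Propositional.Properties.WithK using (unique∧set⇒bag)
open import Data.List.Relation.Binary.BagAndSetEquality using (∼bag⇒↭)
open import Data.List.Relation.Binary.Disjoint.Propositional using (Disjoint)
open import Data.List.Relation.Binary.Permutation.Propositional using (_↭_; ↭⇒↭ₛ)
open import Data.List.Relation.Binary.Permutation.Propositional.Properties using (↭-length)
open import Data.List.Relation.Binary.Permutation.Setoid.Properties using (foldr-commMonoid)
open import Data.List.Relation.Binary.Subset.Propositional using (_⊆_)
open import Data.List.Relation.Unary.All as All using (All; []; _∷_)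
import Data.List.Relation.Unary.All.Properties as All
open import Data.List.Relation.Unary.AllPairs as AllPairs using (AllPairs; []; _∷_)
import Data.List.Relation.Unary.AllPairs.Properties as AllPairs
open import Data.List.Relation.Unary.Any as Any using (Any; here; there; any?)
open import Data.List.Relation.Unary.Unique.Propositional using (Unique)
import Data.List.Relation.Unary.Unique.Propositional.Properties as Unique
open import Data.Maybe using (Maybe; just; nothing)
open import Data.Maybe.Properties using (just-injective)
open import Data.Nat as ℕ using (ℕ; zero; suc; _<_; _≤_; _∸_; _!; z≤n; s≤s)
import Data.Nat.Properties as ℕ
open import Data.Nat.Combinatorics
  using (_C_; nC1≡n; nCn≡1; nCk≡n!/k![n-k]!; k![n∸k]!∣n!; nCk+nC[k+1]≡[n+1]C[k+1])
open import Data.Nat.DivMod using (m/n*n≡m)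
open import Data.Nat.Divisibility using (_∣_; _∤_; divides; ∣⇒≤; m∣m*n; ∣1⇒≡1)
open import Data.Nat.Primality using (Prime; euclidsLemma; ¬prime[0]; ¬prime[1])
open import Data.Nat.Solver using (module +-*-Solver)
open import Data.Product using (Σ; ∃-syntax; _×_; _,_; proj₁; proj₂)
import Data.Product.Properties as Product
open import Data.Sign as Sign using (Sign)
open import Data.Sum using (_⊎_; inj₁; inj₂; [_,_]′)
open import Data.Unit using (⊤; tt)
open import Function using (_∘_; _∘′_)
open import Function.Bundles using (mk⇔; Equivalence)
open import Relation.Binary.Definitions using (DecidableEquality)
open import Relation.Binary.PropositionalEquality
open import Relation.Nullary using (¬_; yes; no; Dec; ¬?)

-- The canonical map ℤ → R is a ring morphism, so the standard solver works in any commutative ring R,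
-- with integer constants.
module IntegerRingSolver {c ℓ} (R : CommutativeRing c ℓ) where

  private
    open CommutativeRing R
      using (Carrier; _≈_; _+_; _*_; -_; _-_; 0#; 1#; ring; semiring; +-abelianGroup;
             -‿cong; *-cong; +-cong; +-congˡ; +-congʳ; +-comm; +-assoc; +-identityˡ; +-identityʳ; -‿inverseʳ)
      renaming (setoid to ≈-setoid; refl to ≈-refl; sym to ≈-sym; trans to ≈-trans; reflexive to ≈-reflexive)
    open import Algebra.Properties.Ring ring using (-‿distribˡ-*; -‿distribʳ-*; -‿involutive; -0#≈0#)
    open import Algebra.Properties.AbelianGroup +-abelianGroup using (⁻¹-∙-comm)
    -- The optimised multiple makes ⟦ + 1 ⟧ reduce to 1#, as the solver's normal forms require.
    open import Algebra.Properties.Semiring.Mult.TCOptimised semiring renaming (_×_ to _×ᵣ_) using (×-homo-+; ×1-homo-*)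
    open import Relation.Binary.Reasoning.Setoid ≈-setoid

    applySign : Sign → Carrier → Carrier
    applySign Sign.+ x = x
    applySign Sign.- x = - x

    ⟦_⟧ : ℤ → Carrier
    ⟦ ℤ.+ n ⟧ = n ×ᵣ 1#
    ⟦ -[1+ n ] ⟧ = - (suc n ×ᵣ 1#)

    ⟦◃⟧ : ∀ s n → ⟦ s ℤ.◃ n ⟧ ≈ applySign s (n ×ᵣ 1#)
    ⟦◃⟧ Sign.+ zero = ≈-refl
    ⟦◃⟧ Sign.- zero = ≈-sym -0#≈0#
    ⟦◃⟧ Sign.+ (suc n) = ≈-refl
    ⟦◃⟧ Sign.- (suc n) = ≈-refl

    applySign-* : ∀ s t x y → applySign (s Sign.* t) (x * y) ≈ applySign s x * applySign t y
    applySign-* Sign.+ Sign.+ x y = ≈-refl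
    applySign-* Sign.+ Sign.- x y = -‿distribʳ-* x y
    applySign-* Sign.- Sign.+ x y = -‿distribˡ-* x y
    applySign-* Sign.- Sign.- x y = begin
      x * y             ≈⟨ -‿involutive _ ⟨
      - - (x * y)       ≈⟨ -‿cong (-‿distribˡ-* x y) ⟩
      - (- x * y)       ≈⟨ -‿distribʳ-* (- x) y ⟩
      - x * - y         ∎

    ⟦⟧-sign : ∀ i → ⟦ i ⟧ ≈ applySign (ℤ.sign i) (ℤ.∣ i ∣ ×ᵣ 1#)
    ⟦⟧-sign i = ≈-trans (≈-reflexive (cong ⟦_⟧ (sym (ℤ.◃-inverse i)))) (⟦◃⟧ (ℤ.sign i) ℤ.∣ i ∣)

    ⟦⟧-* : ∀ i j → ⟦ i ℤ.* j ⟧ ≈ ⟦ i ⟧ * ⟦ j ⟧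
    ⟦⟧-* i j = begin
      ⟦ i ℤ.* j ⟧
        ≈⟨ ⟦◃⟧ (ℤ.sign i Sign.* ℤ.sign j) (ℤ.∣ i ∣ ℕ.* ℤ.∣ j ∣) ⟩
      applySign (ℤ.sign i Sign.* ℤ.sign j) ((ℤ.∣ i ∣ ℕ.* ℤ.∣ j ∣) ×ᵣ 1#)
        ≈⟨ applySign-cong (ℤ.sign i Sign.* ℤ.sign j) (×1-homo-* ℤ.∣ i ∣ ℤ.∣ j ∣) ⟩
      applySign (ℤ.sign i Sign.* ℤ.sign j) ((ℤ.∣ i ∣ ×ᵣ 1#) * (ℤ.∣ j ∣ ×ᵣ 1#))
        ≈⟨ applySign-* (ℤ.sign i) (ℤ.sign j) _ _ ⟩
      applySign (ℤ.sign i) (ℤ.∣ i ∣ ×ᵣ 1#) * applySign (ℤ.sign j) (ℤ.∣ j ∣ ×ᵣ 1#)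
        ≈⟨ *-cong (⟦⟧-sign i) (⟦⟧-sign j) ⟨
      ⟦ i ⟧ * ⟦ j ⟧ ∎
      where
      applySign-cong : ∀ s {x y} → x ≈ y → applySign s x ≈ applySign s y
      applySign-cong Sign.+ e = e
      applySign-cong Sign.- e = -‿cong e

    [1+x]-[1+y] : ∀ x y → (1# + x) - (1# + y) ≈ x - y
    [1+x]-[1+y] x y = begin
      (1# + x) + - (1# + y)    ≈⟨ +-congˡ (⁻¹-∙-comm 1# y) ⟨
      (1# + x) + (- 1# + - y)  ≈⟨ +-congʳ (+-comm 1# x) ⟩
      (x + 1#) + (- 1# + - y)  ≈⟨ +-assoc x 1# _ ⟩
      x + (1# + (- 1# + - y))  ≈⟨ +-congˡ (+-assoc 1# (- 1#) (- y)) ⟨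
      x + ((1# + - 1#) + - y)  ≈⟨ +-congˡ (+-congʳ (-‿inverseʳ 1#)) ⟩
      x + (0# + - y)           ≈⟨ +-congˡ (+-identityˡ _) ⟩
      x + - y                  ∎

    ⟦⊖⟧ : ∀ m n → ⟦ m ⊖ n ⟧ ≈ m ×ᵣ 1# - n ×ᵣ 1#
    ⟦⊖⟧ m zero = ≈-sym (≈-trans (+-congˡ -0#≈0#) (+-identityʳ _))
    ⟦⊖⟧ zero (suc n) = ≈-sym (+-identityˡ _)
    ⟦⊖⟧ (suc m) (suc n) = begin
      ⟦ suc m ⊖ suc n ⟧               ≡⟨ cong ⟦_⟧ (ℤ.[1+m]⊖[1+n]≡m⊖n m n) ⟩
      ⟦ m ⊖ n ⟧                       ≈⟨ ⟦⊖⟧ m n ⟩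
      m ×ᵣ 1# - n ×ᵣ 1#                 ≈⟨ [1+x]-[1+y] _ _ ⟨
      (1# + m ×ᵣ 1#) - (1# + n ×ᵣ 1#)   ≈⟨ +-cong (×-homo-+ 1# 1 m) (-‿cong (×-homo-+ 1# 1 n)) ⟨
      suc m ×ᵣ 1# - suc n ×ᵣ 1#         ∎

    ⟦⟧-+ : ∀ i j → ⟦ i ℤ.+ j ⟧ ≈ ⟦ i ⟧ + ⟦ j ⟧
    ⟦⟧-+ (ℤ.+ m) (ℤ.+ n) = ×-homo-+ 1# m n
    ⟦⟧-+ (ℤ.+ m) -[1+ n ] = ⟦⊖⟧ m (suc n)
    ⟦⟧-+ -[1+ m ] (ℤ.+ n) = ≈-trans (⟦⊖⟧ n (suc m)) (+-comm _ _)
    ⟦⟧-+ -[1+ m ] -[1+ n ] = begin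
      - (suc (suc (m ℕ.+ n)) ×ᵣ 1#)     ≡⟨ cong (λ k → - (suc k ×ᵣ 1#)) (ℕ.+-suc m n) ⟨
      - ((suc m ℕ.+ suc n) ×ᵣ 1#)       ≈⟨ -‿cong (×-homo-+ 1# (suc m) (suc n)) ⟩
      - (suc m ×ᵣ 1# + suc n ×ᵣ 1#)      ≈⟨ ⁻¹-∙-comm _ _ ⟨
      - (suc m ×ᵣ 1#) + - (suc n ×ᵣ 1#)  ∎

    ⟦⟧-neg : ∀ i → ⟦ ℤ.- i ⟧ ≈ - ⟦ i ⟧
    ⟦⟧-neg (ℤ.+ zero) = ≈-sym -0#≈0#
    ⟦⟧-neg (ℤ.+ suc n) = ≈-refl
    ⟦⟧-neg -[1+ n ] = ≈-sym (-‿involutive _)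

    homomorphism : ℤ.+-*-rawRing -Raw-AlmostCommutative⟶ fromCommutativeRing R
    homomorphism = record
      { ⟦_⟧ = ⟦_⟧ ; +-homo = ⟦⟧-+ ; *-homo = ⟦⟧-* ; -‿homo = ⟦⟧-neg
      ; 0-homo = ≈-refl ; 1-homo = ≈-refl }

    equal? : ∀ i j → Maybe (⟦ i ⟧ ≈ ⟦ j ⟧)
    equal? i j with i ℤ.≟ j
    ... | yes refl = just ≈-refl
    ... | no _ = nothing

  open import Algebra.Solver.Ring ℤ.+-*-rawRing (fromCommutativeRing R) homomorphism equal? public

  :0 :1 : ∀ {n} → Polynomial n
  :0 = con (ℤ.+ 0)
  :1 = con (ℤ.+ 1)

module _ {A : Set} where

  ↭-of-⊆⊇ : ∀ {xs ys : List A} → Unique xs → Unique ys → xs ⊆ ys → ys ⊆ xs → xs ↭ ys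
  ↭-of-⊆⊇ ux uy xs⊆ys ys⊆xs = ∼bag⇒↭ (unique∧set⇒bag ux uy (mk⇔ xs⊆ys ys⊆xs))

  HasSize-unique : ∀ {P : A → Set} {m n} → HasSize A P m → HasSize A P n → m ≡ n
  HasSize-unique (xs , ux , Pxs , xs-complete , refl) (ys , uy , Pys , ys-complete , refl) =
    ↭-length (↭-of-⊆⊇ ux uy (λ m → ys-complete _ (All.lookup Pxs m)) (λ m → xs-complete _ (All.lookup Pys m)))

  Unique-∷ : ∀ {x} {xs : List A} → x ∉ xs → Unique xs → Unique (x ∷ xs)
  Unique-∷ x∉xs uxs = All.¬Any⇒All¬ _ x∉xs ∷ uxs

  ∈-[x]⁻ : ∀ {x y : A} → y ∈ x ∷ [] → y ≡ x
  ∈-[x]⁻ (here y≡x) = y≡x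

  unorderedPairs : List A → List (A × A)
  unorderedPairs [] = []
  unorderedPairs (a ∷ as) = map (a ,_) (a ∷ as) ++ unorderedPairs as

  ∈-unorderedPairs⁻ : ∀ xs {u v} → (u , v) ∈ unorderedPairs xs → u ∈ xs × v ∈ xs
  ∈-unorderedPairs⁻ (a ∷ as) uv∈ with ∈-++⁻ (map (a ,_) (a ∷ as)) uv∈
  ... | inj₁ uv∈row with ∈-map⁻ (a ,_) uv∈row
  ...   | _ , v∈ , refl = here refl , v∈
  ∈-unorderedPairs⁻ (a ∷ as) uv∈ | inj₂ uv∈rest = let u∈ , v∈ = ∈-unorderedPairs⁻ as uv∈rest in there u∈ , there v∈

  length-unorderedPairs : ∀ xs → length (unorderedPairs xs) ℕ.+ length (unorderedPairs xs) ≡ length xs ℕ.* suc (length xs)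
  length-unorderedPairs [] = refl
  length-unorderedPairs (a ∷ as) = begin
    |pairs| ℕ.+ |pairs|                 ≡⟨ cong (λ z → z ℕ.+ z) |pairs|≡1+n+r ⟩
    (suc n ℕ.+ r) ℕ.+ (suc n ℕ.+ r)         ≡⟨ solve 2 (λ n r → (con 1 :+ n :+ r) :+ (con 1 :+ n :+ r) := (con 1 :+ n :+ (con 1 :+ n)) :+ (r :+ r)) refl n r ⟩
    (suc n ℕ.+ suc n) ℕ.+ (r ℕ.+ r)         ≡⟨ cong ((suc n ℕ.+ suc n) ℕ.+_) (length-unorderedPairs as) ⟩
    (suc n ℕ.+ suc n) ℕ.+ n ℕ.* suc n     ≡⟨ solve 1 (λ n → (con 1 :+ n :+ (con 1 :+ n)) :+ n :* (con 1 :+ n) := (con 1 :+ n) :* (con 1 :+ (con 1 :+ n))) refl n ⟩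
    suc n ℕ.* suc (suc n)             ∎
    where
    open ≡-Reasoning
    open +-*-Solver
    n = length as
    r = length (unorderedPairs as)
    |pairs| = length (unorderedPairs (a ∷ as))
    |pairs|≡1+n+r : |pairs| ≡ suc n ℕ.+ r
    |pairs|≡1+n+r = trans (length-++ (map (a ,_) (a ∷ as))) (cong (ℕ._+ r) (length-map (a ,_) (a ∷ as)))

  length-cartesianProduct : ∀ {B : Set} (xs : List A) (ys : List B) → length (cartesianProduct xs ys) ≡ length xs ℕ.* length ys
  length-cartesianProduct [] ys = refl
  length-cartesianProduct (x ∷ xs) ys =
    trans (length-++ (map (x ,_) ys)) (cong₂ ℕ._+_ (length-map (x ,_) ys) (length-cartesianProduct xs ys))

  AllPairs-mapWithAll : ∀ {P : A → Set} {R S : A → A → Set} → (∀ {x y} → P x → P y → R x y → S x y) →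
                        ∀ {xs} → All P xs → AllPairs R xs → AllPairs S xs
  AllPairs-mapWithAll f [] [] = []
  AllPairs-mapWithAll f (px ∷ pxs) (Rx ∷ Rxs) = All.zipWith (λ (py , Rxy) → f px py Rxy) (pxs , Rx) ∷ AllPairs-mapWithAll f pxs Rxs

  length-concatMap : ∀ {B : Set} (f : B → List A) m xs → (∀ x → length (f x) ≡ m) → length (concatMap f xs) ≡ length xs ℕ.* m
  length-concatMap f m [] _ = refl
  length-concatMap f m (x ∷ xs) |f|≡m = trans (length-++ (f x)) (cong₂ ℕ._+_ (|f|≡m x) (length-concatMap f m xs |f|≡m))

module DistinctLists {A : Set} (_≟_ : DecidableEquality A) where

  open import Data.List.Membership.DecPropositional _≟_ using (_∈?_)

  length-mono-⊆ : ∀ {xs ys : List A} → Unique xs → Unique ys → xs ⊆ ys → length xs ≤ length ys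
  length-mono-⊆ {xs} {ys} ux uy xs⊆ys = begin
    length xs                     ≡⟨ ↭-length (↭-of-⊆⊇ ux (Unique.filter⁺ (_∈? xs) uy) into out) ⟩
    length (filter (_∈? xs) ys)   ≤⟨ length-filter (_∈? xs) ys ⟩
    length ys                     ∎
    where
    open ℕ.≤-Reasoning
    into : xs ⊆ filter (_∈? xs) ys
    into m = ∈-filter⁺ (_∈? xs) (xs⊆ys m) m
    out : filter (_∈? xs) ys ⊆ xs
    out m = proj₂ (∈-filter⁻ (_∈? xs) {xs = ys} m)

  HasSize-complete : ∀ {P : A → Set} {n} → HasSize A P n → (ys : List A) → Unique ys → All P ys →
                     length ys ≡ n → ∀ x → P x → x ∈ ys
  HasSize-complete (xs , ux , _ , xs-complete , refl) ys uy Pys |ys|≡|xs| x Px with x ∈? ys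
  ... | yes x∈ys = x∈ys
  ... | no x∉ys = ⊥-elim (ℕ.<-irrefl |ys|≡|xs| (length-mono-⊆ (Unique-∷ x∉ys uy) ux x∷ys⊆xs))
    where
    x∷ys⊆xs : x ∷ ys ⊆ xs
    x∷ys⊆xs (here refl) = xs-complete x Px
    x∷ys⊆xs (there m) = xs-complete _ (All.lookup Pys m)

  without : A → List A → List A
  without a = filter (λ y → ¬? (y ≟ a))

  ∈-without⁻ : ∀ {a x} xs → x ∈ without a xs → x ∈ xs × x ≢ a
  ∈-without⁻ {a} xs = ∈-filter⁻ (λ y → ¬? (y ≟ a)) {xs = xs}

  ∈-without⁺ : ∀ {a x xs} → x ∈ xs → x ≢ a → x ∈ without a xs
  ∈-without⁺ {a} = ∈-filter⁺ (λ y → ¬? (y ≟ a))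

  Unique-without : ∀ {a xs} → Unique xs → Unique (without a xs)
  Unique-without {a} = Unique.filter⁺ (λ y → ¬? (y ≟ a))

  length-without : ∀ {a xs} → Unique xs → a ∈ xs → suc (length (without a xs)) ≡ length xs
  length-without {a} {x ∷ xs} (x∉xs ∷ _) (here refl) = begin
    suc (length (without x (x ∷ xs)))  ≡⟨ cong (suc ∘′ length) (filter-reject (λ y → ¬? (y ≟ x)) (λ x≢x → x≢x refl)) ⟩
    suc (length (without x xs))        ≡⟨ cong (suc ∘′ length) (filter-all (λ y → ¬? (y ≟ x)) (All.map (λ x≢y y≡x → x≢y (sym y≡x)) x∉xs)) ⟩
    suc (length xs)                    ∎
    where open ≡-Reasoning
  length-without {a} {x ∷ xs} (x∉xs ∷ uxs) (there a∈xs) = begin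
    suc (length (without a (x ∷ xs)))  ≡⟨ cong (suc ∘′ length) (filter-accept (λ y → ¬? (y ≟ a)) (All.lookup x∉xs a∈xs)) ⟩
    suc (suc (length (without a xs)))  ≡⟨ cong suc (length-without uxs a∈xs) ⟩
    suc (length xs)                    ∎
    where open ≡-Reasoning

  module ConjugatePairs (c : A → A) (c-involutive : ∀ x → c (c x) ≡ x) where

    Closed : List A → Set
    Closed xs = ∀ {x} → x ∈ xs → c x ∈ xs × c x ≢ x

    representatives : ℕ → List A → List A
    representatives zero _ = []
    representatives (suc n) [] = []
    representatives (suc n) (x ∷ xs) = x ∷ representatives n (without (c x) xs)

    record Representatives (xs R : List A) : Set where
      field
        ⊆-all : R ⊆ xs
        pairwise-distinct : AllPairs (λ a b → a ≢ b × a ≢ c b) R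
        cover : ∀ {x} → x ∈ xs → x ∈ R ⊎ c x ∈ R
        twice-length : length R ℕ.+ length R ≡ length xs

    -- The fuel n only has to bound the length of the list.
    representatives-correct : ∀ n xs → Unique xs → Closed xs → length xs ≤ n →
                              Representatives xs (representatives n xs)
    representatives-correct zero [] _ _ _ = record { ⊆-all = λ () ; pairwise-distinct = [] ; cover = λ () ; twice-length = refl }
    representatives-correct (suc n) [] _ _ _ = record { ⊆-all = λ () ; pairwise-distinct = [] ; cover = λ () ; twice-length = refl }
    representatives-correct (suc n) (x ∷ xs) (x∉xs ∷ uxs) closed (s≤s |xs|≤n) = record
      { ⊆-all = ⊆-all ; pairwise-distinct = pairwise-distinct ; cover = cover ; twice-length = twice-length }
      where
      rest = without (c x) xs
      cx∈xs : c x ∈ xs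
      cx∈xs with closed (here refl)
      ... | here cx≡x , cx≢x = ⊥-elim (cx≢x cx≡x)
      ... | there cx∈xs , _ = cx∈xs
      |rest|+1≡|xs| : suc (length rest) ≡ length xs
      |rest|+1≡|xs| = length-without uxs cx∈xs
      x≢ : ∀ {y} → y ∈ xs → x ≢ y
      x≢ y∈xs = All.lookup x∉xs y∈xs
      c-injective : ∀ {y z} → c y ≡ c z → y ≡ z
      c-injective {y} {z} e = trans (sym (c-involutive y)) (trans (cong c e) (c-involutive z))
      rest-closed : Closed rest
      rest-closed {y} y∈rest = ∈-without⁺ cy∈xs (λ cy≡cx → x≢ y∈xs (sym (c-injective cy≡cx))) , proj₂ (closed (there y∈xs))
        where
        y∈xs : y ∈ xs
        y∈xs = proj₁ (∈-without⁻ xs y∈rest)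
        cy∈xs : c y ∈ xs
        cy∈xs with closed (there y∈xs)
        ... | here cy≡x , _ = ⊥-elim (proj₂ (∈-without⁻ xs y∈rest) (trans (sym (c-involutive y)) (cong c cy≡x)))
        ... | there cy∈xs , _ = cy∈xs
      module IH = Representatives
        (representatives-correct n rest (Unique-without uxs) rest-closed
          (ℕ.≤-trans (ℕ.n≤1+n _) (ℕ.≤-trans (ℕ.≤-reflexive |rest|+1≡|xs|) |xs|≤n)))
      R = representatives n rest
      ⊆-all : x ∷ R ⊆ x ∷ xs
      ⊆-all (here e) = here e
      ⊆-all (there m) = there (proj₁ (∈-without⁻ xs (IH.⊆-all m)))
      pairwise-distinct : AllPairs (λ a b → a ≢ b × a ≢ c b) (x ∷ R)
      pairwise-distinct = All.tabulate separated ∷ IH.pairwise-distinct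
        where
        separated : ∀ {b} → b ∈ R → x ≢ b × x ≢ c b
        separated b∈R = let b∈xs , b≢cx = ∈-without⁻ xs (IH.⊆-all b∈R) in
          x≢ b∈xs , λ x≡cb → b≢cx (trans (sym (c-involutive _)) (cong c (sym x≡cb)))
      cover : ∀ {y} → y ∈ x ∷ xs → y ∈ x ∷ R ⊎ c y ∈ x ∷ R
      cover (here refl) = inj₁ (here refl)
      cover {y} (there y∈xs) with y ≟ c x
      ... | yes refl = inj₂ (here (c-involutive x))
      ... | no y≢cx with IH.cover (∈-without⁺ y∈xs y≢cx)
      ... | inj₁ y∈R = inj₁ (there y∈R)
      ... | inj₂ cy∈R = inj₂ (there cy∈R)
      twice-length : suc (length R) ℕ.+ suc (length R) ≡ suc (length xs)
      twice-length = cong suc (trans (ℕ.+-suc (length R) (length R)) (trans (cong suc IH.twice-length) |rest|+1≡|xs|))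

module FieldProperties {q : ℕ} (F : FiniteField q) where

  open FiniteField F public
  commutativeRing : CommutativeRing _ _
  commutativeRing = record { isCommutativeRing = isCommutativeRing }
  open CommutativeRing commutativeRing public
    using (_-_; +-assoc; +-comm; *-assoc; *-comm; +-identityˡ; +-identityʳ; *-identityˡ; *-identityʳ;
           -‿inverseˡ; -‿inverseʳ; zeroˡ; zeroʳ;
           +-commutativeMonoid; *-commutativeMonoid; semiring; +-group)
  open IntegerRingSolver commutativeRing public
  open import Algebra.Properties.Group +-group public
    using (x∙y⁻¹≈ε⇒x≈y; x≈y⇒x∙y⁻¹≈ε; inverseˡ-unique; ⁻¹-injective)
  open import Algebra.Properties.RingWithoutOne (Ring.ringWithoutOne (CommutativeRing.ring commutativeRing)) public
    using (x+x≈x⇒x≈0)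
  open import Algebra.Properties.Semiring.Mult semiring
    renaming (_×_ to _×ᵣ_) using (×1-homo-*)

  1≢0 : 1# ≢ 0#
  1≢0 e = 0≢1 (sym e)

  x*y≡1⇒y≢0 : ∀ {x y} → x * y ≡ 1# → y ≢ 0#
  x*y≡1⇒y≢0 {x} xy≡1 y≡0 = 1≢0 (trans (sym xy≡1) (trans (cong (x *_) y≡0) (zeroʳ x)))

  noZeroDivisors : ∀ {x y} → x * y ≡ 0# → x ≡ 0# ⊎ y ≡ 0#
  noZeroDivisors {x} {y} xy≡0 with x ≟ 0#
  ... | yes x≡0 = inj₁ x≡0
  ... | no x≢0 = let x⁻¹ , xx⁻¹≡1 = inverse x x≢0 in inj₂ (begin
      y                ≡⟨ *-identityˡ y ⟨
      1# * y           ≡⟨ cong (_* y) xx⁻¹≡1 ⟨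
      (x * x⁻¹) * y    ≡⟨ solve 3 (λ x x⁻¹ y → (x :* x⁻¹) :* y := x⁻¹ :* (x :* y)) refl x x⁻¹ y ⟩
      x⁻¹ * (x * y)    ≡⟨ cong (x⁻¹ *_) xy≡0 ⟩
      x⁻¹ * 0#         ≡⟨ zeroʳ x⁻¹ ⟩
      0#               ∎)
    where open ≡-Reasoning

  *-nonzero : ∀ {x y} → x ≢ 0# → y ≢ 0# → x * y ≢ 0#
  *-nonzero x≢0 y≢0 xy≡0 with noZeroDivisors xy≡0
  ... | inj₁ x≡0 = x≢0 x≡0
  ... | inj₂ y≡0 = y≢0 y≡0

  *-cancelˡ-0 : ∀ {x y} → x ≢ 0# → x * y ≡ 0# → y ≡ 0#
  *-cancelˡ-0 x≢0 xy≡0 with noZeroDivisors xy≡0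
  ... | inj₁ x≡0 = ⊥-elim (x≢0 x≡0)
  ... | inj₂ y≡0 = y≡0

  *-cancelʳ-0 : ∀ {x y} → y ≢ 0# → x * y ≡ 0# → x ≡ 0#
  *-cancelʳ-0 y≢0 xy≡0 = *-cancelˡ-0 y≢0 (trans (*-comm _ _) xy≡0)

  *-cancelˡ : ∀ {x y z} → x ≢ 0# → x * y ≡ x * z → y ≡ z
  *-cancelˡ {x} {y} {z} x≢0 xy≡xz = x∙y⁻¹≈ε⇒x≈y y z (*-cancelˡ-0 x≢0 (begin
      x * (y - z)      ≡⟨ solve 3 (λ x y z → x :* (y :- z) := x :* y :- x :* z) refl x y z ⟩
      x * y - x * z    ≡⟨ x≈y⇒x∙y⁻¹≈ε xy≡xz ⟩
      0#               ∎))
    where open ≡-Reasoning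

  x+y≡0⇒x≡-y : ∀ {x y} → x + y ≡ 0# → x ≡ - y
  x+y≡0⇒x≡-y {x} {y} = inverseˡ-unique x y

  x-y≡0⇒x≡y : ∀ {x y} → x - y ≡ 0# → x ≡ y
  x-y≡0⇒x≡y {x} {y} = x∙y⁻¹≈ε⇒x≈y x y

  pow-+ : ∀ x m n → pow x (m ℕ.+ n) ≡ pow x m * pow x n
  pow-+ x zero n = sym (*-identityˡ _)
  pow-+ x (suc m) n = trans (cong (x *_) (pow-+ x m n)) (sym (*-assoc _ _ _))

  pow-* : ∀ x m n → pow x (m ℕ.* n) ≡ pow (pow x m) n
  pow-* x m zero rewrite ℕ.*-zeroʳ m = refl
  pow-* x m (suc n) = begin
    pow x (m ℕ.* suc n)             ≡⟨ cong (pow x) (ℕ.*-suc m n) ⟩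
    pow x (m ℕ.+ m ℕ.* n)           ≡⟨ pow-+ x m (m ℕ.* n) ⟩
    pow x m * pow x (m ℕ.* n)       ≡⟨ cong (pow x m *_) (pow-* x m n) ⟩
    pow x m * pow (pow x m) n       ∎
    where open ≡-Reasoning

  pow-distrib-* : ∀ x y n → pow (x * y) n ≡ pow x n * pow y n
  pow-distrib-* x y zero = sym (*-identityˡ 1#)
  pow-distrib-* x y (suc n) = trans (cong ((x * y) *_) (pow-distrib-* x y n))
    (solve 4 (λ x y a b → (x :* y) :* (a :* b) := (x :* a) :* (y :* b)) refl x y (pow x n) (pow y n))

  pow-1 : ∀ n → pow 1# n ≡ 1#
  pow-1 zero = refl
  pow-1 (suc n) = trans (*-identityˡ _) (pow-1 n)

  pow-nonzero : ∀ {x} n → x ≢ 0# → pow x n ≢ 0#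
  pow-nonzero zero x≢0 = 1≢0
  pow-nonzero (suc n) x≢0 = *-nonzero x≢0 (pow-nonzero n x≢0)

  pow≡0⇒≡0 : ∀ {x} n → pow x n ≡ 0# → x ≡ 0#
  pow≡0⇒≡0 {x} n xⁿ≡0 with x ≟ 0#
  ... | yes x≡0 = x≡0
  ... | no x≢0 = ⊥-elim (pow-nonzero n x≢0 xⁿ≡0)

  fromℕ : ℕ → Carrier
  fromℕ n = n ×ᵣ 1#

  fromℕ-^ : ∀ m k → fromℕ (m ℕ.^ k) ≡ pow (fromℕ m) k
  fromℕ-^ m zero = +-identityʳ 1#
  fromℕ-^ m (suc k) = trans (×1-homo-* m (m ℕ.^ k)) (cong (fromℕ m *_) (fromℕ-^ m k))

  elements : List Carrier
  elements = proj₁ card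

  elements-unique : Unique elements
  elements-unique = proj₁ (proj₂ card)

  ∈-elements : ∀ x → x ∈ elements
  ∈-elements x = proj₁ (proj₂ (proj₂ (proj₂ card))) x tt

  length-elements : length elements ≡ q
  length-elements = proj₂ (proj₂ (proj₂ (proj₂ card)))

  open DistinctLists _≟_ public

  private
    sum product : List Carrier → Carrier
    sum = foldr _+_ 0#
    product = foldr _*_ 1#

    sum-↭ : ∀ {xs ys} → xs ↭ ys → sum xs ≡ sum ys
    sum-↭ xs↭ys = foldr-commMonoid (setoid Carrier) (CommutativeMonoid.isCommutativeMonoid +-commutativeMonoid) (↭⇒↭ₛ xs↭ys)

    product-↭ : ∀ {xs ys} → xs ↭ ys → product xs ≡ product ys
    product-↭ xs↭ys = foldr-commMonoid (setoid Carrier) (CommutativeMonoid.isCommutativeMonoid *-commutativeMonoid) (↭⇒↭ₛ xs↭ys)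

    map-↭ : ∀ (f : Carrier → Carrier) (f⁻¹ : Carrier → Carrier) → (∀ x → f (f⁻¹ x) ≡ x) → (∀ {x y} → f x ≡ f y → x ≡ y) →
            ∀ {xs} → Unique xs → (∀ {x} → x ∈ xs → f x ∈ xs) → (∀ {x} → x ∈ xs → f⁻¹ x ∈ xs) → map f xs ↭ xs
    map-↭ f f⁻¹ ff⁻¹ f-injective uxs f-closed f⁻¹-closed = ↭-of-⊆⊇ (Unique.map⁺ f-injective uxs) uxs out into
      where
      out : ∀ {y} → y ∈ map f _ → y ∈ _
      out y∈fxs with ∈-map⁻ f y∈fxs
      ... | x , x∈xs , refl = f-closed x∈xs
      into : ∀ {y} → y ∈ _ → y ∈ map f _
      into {y} y∈xs = subst (_∈ map f _) (ff⁻¹ y) (∈-map⁺ f (f⁻¹-closed y∈xs))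

    sum-map-+ : ∀ c xs → sum (map (c +_) xs) ≡ sum xs + length xs ×ᵣ c
    sum-map-+ c [] = sym (+-identityʳ 0#)
    sum-map-+ c (x ∷ xs) = begin
      (c + x) + sum (map (c +_) xs)           ≡⟨ cong ((c + x) +_) (sum-map-+ c xs) ⟩
      (c + x) + (sum xs + length xs ×ᵣ c)     ≡⟨ solve 4 (λ c x s m → (c :+ x) :+ (s :+ m) := (x :+ s) :+ (c :+ m)) refl c x (sum xs) _ ⟩
      (x + sum xs) + (c + length xs ×ᵣ c)     ≡⟨⟩
      (x + sum xs) + suc (length xs) ×ᵣ c     ∎
      where open ≡-Reasoning

    product-map-* : ∀ c xs → product (map (c *_) xs) ≡ pow c (length xs) * product xs
    product-map-* c [] = sym (*-identityʳ 1#)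
    product-map-* c (x ∷ xs) = trans (cong ((c * x) *_) (product-map-* c xs))
      (solve 4 (λ c x cⁿ p → (c :* x) :* (cⁿ :* p) := (c :* cⁿ) :* (x :* p)) refl c x (pow c (length xs)) _)

  -- Translation by 1 permutes the field, so it leaves the sum of all elements unchanged.
  characteristic : fromℕ q ≡ 0#
  characteristic = begin
    fromℕ q                            ≡⟨ cong fromℕ length-elements ⟨
    length elements ×ᵣ 1#              ≡⟨ solve 2 (λ s m → m := (s :+ m) :- s) refl (sum elements) _ ⟩
    (sum elements + length elements ×ᵣ 1#) - sum elements
                                       ≡⟨ cong (_- sum elements) (sum-map-+ 1# elements) ⟨
    sum (map (1# +_) elements) - sum elements
                                       ≡⟨ x≈y⇒x∙y⁻¹≈ε (sum-↭ translation-permutes) ⟩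
    0#                                 ∎
    where
    open ≡-Reasoning
    translation-permutes : map (1# +_) elements ↭ elements
    translation-permutes = map-↭ (1# +_) (_- 1#) (λ x → solve 1 (λ x → :1 :+ (x :- :1) := x) refl x)
      (λ {x} {y} e → trans (solve 1 (λ x → x := (:1 :+ x) :- :1) refl x) (trans (cong (_- 1#) e) (solve 1 (λ y → (:1 :+ y) :- :1 := y) refl y)))
      elements-unique (λ {x} _ → ∈-elements (1# + x)) (λ {x} _ → ∈-elements (x - 1#))

  nonzero : List Carrier
  nonzero = without 0# elements

  length-nonzero : suc (length nonzero) ≡ q
  length-nonzero = trans (length-without elements-unique (∈-elements 0#)) length-elements

  -- Multiplication by x ≢ 0 permutes the nonzero elements, so x ^ (q - 1) = 1.
  fermat : ∀ x → pow x q ≡ x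
  fermat x with x ≟ 0#
  ... | yes refl = subst (λ n → pow 0# n ≡ 0#) length-nonzero (zeroˡ _)
  ... | no x≢0 = begin
    pow x q                               ≡⟨ cong (pow x) length-nonzero ⟨
    x * pow x (length nonzero)            ≡⟨ cong (x *_) xⁿ≡1 ⟩
    x * 1#                                ≡⟨ *-identityʳ x ⟩
    x                                     ∎
    where
    open ≡-Reasoning
    x⁻¹ = proj₁ (inverse x x≢0)
    xx⁻¹≡1 : x * x⁻¹ ≡ 1#
    xx⁻¹≡1 = proj₂ (inverse x x≢0)
    ∈-nonzero : ∀ {y} → y ≢ 0# → y ∈ nonzero
    ∈-nonzero y≢0 = ∈-without⁺ (∈-elements _) y≢0
    nonzero-≢0 : ∀ {y} → y ∈ nonzero → y ≢ 0#
    nonzero-≢0 = proj₂ ∘′ ∈-without⁻ elements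
    product-nonzero : ∀ ys → (∀ {y} → y ∈ ys → y ≢ 0#) → product ys ≢ 0#
    product-nonzero [] _ = 1≢0
    product-nonzero (y ∷ ys) ys≢0 = *-nonzero (ys≢0 (here refl)) (product-nonzero ys (ys≢0 ∘′ there))
    scaling-permutes : map (x *_) nonzero ↭ nonzero
    scaling-permutes = map-↭ (x *_) (x⁻¹ *_)
      (λ y → trans (sym (*-assoc x x⁻¹ y)) (trans (cong (_* y) xx⁻¹≡1) (*-identityˡ y)))
      (*-cancelˡ x≢0) (Unique-without elements-unique)
      (λ y∈ → ∈-nonzero (*-nonzero x≢0 (nonzero-≢0 y∈)))
      (λ y∈ → ∈-nonzero (*-nonzero (x*y≡1⇒y≢0 xx⁻¹≡1) (nonzero-≢0 y∈)))
    xⁿ≡1 : pow x (length nonzero) ≡ 1#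
    xⁿ≡1 = *-cancelˡ (product-nonzero nonzero nonzero-≢0) (begin
      product nonzero * pow x (length nonzero)   ≡⟨ *-comm _ _ ⟩
      pow x (length nonzero) * product nonzero   ≡⟨ product-map-* x nonzero ⟨
      product (map (x *_) nonzero)               ≡⟨ product-↭ scaling-permutes ⟩
      product nonzero                            ≡⟨ *-identityʳ _ ⟨
      product nonzero * 1#                       ∎)

prime∤! : ∀ {p m} → Prime p → m < p → p ∤ m !
prime∤! {m = zero} p-prime _ p∣1 = ¬prime[1] (subst Prime (∣1⇒≡1 p∣1) p-prime)
prime∤! {m = suc m} p-prime m<p p∣m! with euclidsLemma (suc m) (m !) p-prime p∣m!
... | inj₁ p∣1+m = ℕ.<-irrefl refl (ℕ.<-≤-trans m<p (∣⇒≤ p∣1+m))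
... | inj₂ p∣m! = prime∤! p-prime (ℕ.<-trans (ℕ.n<1+n m) m<p) p∣m!

nCk*[k!*[n∸k]!]≡n! : ∀ {n k} → k ≤ n → (n C k) ℕ.* (k ! ℕ.* (n ∸ k) !) ≡ n !
nCk*[k!*[n∸k]!]≡n! {n} {k} k≤n =
  trans (cong (ℕ._* (k ! ℕ.* (n ∸ k) !)) (nCk≡n!/k![n-k]! k≤n)) (m/n*n≡m (k![n∸k]!∣n! k≤n))
  where instance _ = ℕ.m*n≢0 (k !) ((n ∸ k) !) {{k ℕ.!≢0}} {{(n ∸ k) ℕ.!≢0}}

prime∣C : ∀ {p k} → Prime p → 0 < k → k < p → p ∣ p C k
prime∣C {suc p'} {k} p-prime 0<k k<p
  with euclidsLemma (suc p' C k) (k ! ℕ.* (suc p' ∸ k) !) p-prime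
         (subst (suc p' ∣_) (sym (nCk*[k!*[n∸k]!]≡n! (ℕ.<⇒≤ k<p))) (m∣m*n (p' !)))
... | inj₁ p∣pCk = p∣pCk
... | inj₂ p∣k!*[p∸k]! with euclidsLemma (k !) ((suc p' ∸ k) !) p-prime p∣k!*[p∸k]!
...   | inj₁ p∣k! = ⊥-elim (prime∤! p-prime k<p p∣k!)
...   | inj₂ p∣[p∸k]! = ⊥-elim (prime∤! p-prime (ℕ.∸-monoʳ-< 0<k (ℕ.<⇒≤ k<p)) p∣[p∸k]!)

module FreshmansDream {r} (K : FiniteField r) {p} (p-prime : Prime p) (char-p : FieldProperties.fromℕ K p ≡ FiniteField.0# K) where

  open FieldProperties K
  open CommutativeRing commutativeRing using (commutativeSemiring)
  open import Algebra.Properties.Semiring.Exp semiring using (_^_)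
  open import Algebra.Properties.Semiring.Mult semiring renaming (_×_ to _×ᵣ_) using (×1-homo-*; ×-assoc-*)
  open import Algebra.Properties.CommutativeSemiring.Binomial commutativeSemiring using (theorem; binomialExpansion; binomialTerm)
  open import Algebra.Properties.Monoid.Sum (CommutativeRing.+-monoid commutativeRing) using (sum; sum-init-last; sum-cong-≗; sum-replicate-zero)

  pow≡^ : ∀ x n → pow x n ≡ x ^ n
  pow≡^ x zero = refl
  pow≡^ x (suc n) = cong (x *_) (pow≡^ x n)

  multiple-of-p≡0 : ∀ {m} z → p ∣ m → m ×ᵣ z ≡ 0#
  multiple-of-p≡0 {m} z (divides d refl) = begin
    (d ℕ.* p) ×ᵣ z                  ≡⟨ cong ((d ℕ.* p) ×ᵣ_) (*-identityˡ z) ⟨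
    (d ℕ.* p) ×ᵣ (1# * z)           ≡⟨ ×-assoc-* (d ℕ.* p) 1# z ⟨
    ((d ℕ.* p) ×ᵣ 1#) * z           ≡⟨ cong (_* z) (×1-homo-* d p) ⟩
    ((d ×ᵣ 1#) * (p ×ᵣ 1#)) * z      ≡⟨ cong (λ c → ((d ×ᵣ 1#) * c) * z) char-p ⟩
    ((d ×ᵣ 1#) * 0#) * z            ≡⟨ solve 2 (λ a z → (a :* :0) :* z := :0) refl (d ×ᵣ 1#) z ⟩
    0#                             ∎
    where open ≡-Reasoning

  freshmansDream : ∀ x y → pow (x + y) p ≡ pow x p + pow y p
  freshmansDream x y = dream p refl
    where
    dream : ∀ n → n ≡ p → pow (x + y) n ≡ pow x n + pow y n
    dream zero refl = ⊥-elim (¬prime[0] p-prime)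
    dream (suc p') refl = begin
      pow (x + y) (suc p')                               ≡⟨ pow≡^ (x + y) (suc p') ⟩
      (x + y) ^ suc p'                                   ≡⟨ theorem (suc p') x y ⟩
      binomialExpansion x y (suc p')                     ≡⟨ cong (term Fin.zero +_) (sum-init-last (λ i → term (Fin.suc i))) ⟩
      term Fin.zero + (sum middle + term (Fin.suc (Fin.fromℕ p')))
                                                         ≡⟨ cong (λ s → term Fin.zero + (s + term (Fin.suc (Fin.fromℕ p')))) middle≡0 ⟩
      term Fin.zero + (0# + term (Fin.suc (Fin.fromℕ p')))   ≡⟨ cong₂ (λ a b → a + (0# + b)) first-term last-term ⟩
      pow y (suc p') + (0# + pow x (suc p'))             ≡⟨ solve 2 (λ a b → b :+ (:0 :+ a) := a :+ b) refl (pow x (suc p')) (pow y (suc p')) ⟩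
      pow x (suc p') + pow y (suc p')                    ∎
      where
      open ≡-Reasoning
      term = binomialTerm x y (suc p')
      first-term : term Fin.zero ≡ pow y (suc p')
      first-term = trans (+-identityʳ _) (trans (*-identityˡ _) (sym (pow≡^ y (suc p'))))
      last-term : term (Fin.suc (Fin.fromℕ p')) ≡ pow x (suc p')
      last-term = begin
        (suc p' C suc (toℕ (Fin.fromℕ p'))) ×ᵣ (x ^ suc (toℕ (Fin.fromℕ p')) * y ^ (p' ∸ toℕ (Fin.fromℕ p')))
          ≡⟨ cong (λ k → (suc p' C suc k) ×ᵣ (x ^ suc k * y ^ (p' ∸ k))) (Fin.toℕ-fromℕ p') ⟩
        (suc p' C suc p') ×ᵣ (x ^ suc p' * y ^ (p' ∸ p'))
          ≡⟨ cong₂ (λ c k → c ×ᵣ (x ^ suc p' * y ^ k)) (nCn≡1 (suc p')) (ℕ.n∸n≡0 p') ⟩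
        1 ×ᵣ (x ^ suc p' * 1#)
          ≡⟨ trans (+-identityʳ _) (*-identityʳ _) ⟩
        x ^ suc p'
          ≡⟨ pow≡^ x (suc p') ⟨
        pow x (suc p') ∎
      inner<p′ : ∀ (i : Fin p') → toℕ (inject₁ i) < p'
      inner<p′ i = ℕ.≤-trans (ℕ.≤-reflexive (cong suc (Fin.toℕ-inject₁ i))) (Fin.toℕ<n i)
      middle : Fin p' → Carrier
      middle i = term (Fin.suc (inject₁ i))
      middle≡0 : sum middle ≡ 0#
      middle≡0 = trans (sum-cong-≗ (λ i → multiple-of-p≡0 _ (prime∣C p-prime (s≤s z≤n) (s≤s (inner<p′ i)))))
                       (sum-replicate-zero p')

module Polynomials {q : ℕ} (F : FiniteField q) where

  open FieldProperties F

  -- Coefficient lists, constant term first.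
  eval : List Carrier → Carrier → Carrier
  eval [] x = 0#
  eval (c ∷ cs) x = c + x * eval cs x

  IsZero : List Carrier → Set
  IsZero = All (_≡ 0#)

  private
    -- Synthetic division: the quotient of c + X·cs by X - r, which does not depend on c.
    quotient : Carrier → List Carrier → List Carrier
    quotient r [] = []
    quotient r (d ∷ ds) = eval (d ∷ ds) r ∷ quotient r ds

    length-quotient : ∀ r cs → length (quotient r cs) ≡ length cs
    length-quotient r [] = refl
    length-quotient r (d ∷ ds) = cong suc (length-quotient r ds)

    eval-division : ∀ r x c cs → eval (c ∷ cs) x ≡ (x - r) * eval (quotient r cs) x + eval (c ∷ cs) r
    eval-division r x c [] = solve 3 (λ r x c → c :+ x :* :0 := (x :- r) :* :0 :+ (c :+ r :* :0)) refl r x c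
    eval-division r x c (d ∷ ds) = trans (cong (λ z → c + x * z) (eval-division r x d ds))
      (solve 5 (λ r x c A B → c :+ x :* ((x :- r) :* A :+ B) := (x :- r) :* (B :+ x :* A) :+ (c :+ r :* B))
        refl r x c (eval (quotient r ds) x) (eval (d ∷ ds) r))

    eval-zero : ∀ cs x → IsZero cs → eval cs x ≡ 0#
    eval-zero [] x _ = refl
    eval-zero (c ∷ cs) x (c≡0 ∷ cs≡0) = begin
      c + x * eval cs x     ≡⟨ cong₂ (λ u v → u + x * v) c≡0 (eval-zero cs x cs≡0) ⟩
      0# + x * 0#           ≡⟨ solve 1 (λ x → :0 :+ x :* :0 := :0) refl x ⟩
      0#                    ∎
      where open ≡-Reasoning

    head≡eval : ∀ r c cs → IsZero cs → eval (c ∷ cs) r ≡ c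
    head≡eval r c cs cs≡0 = trans (cong (λ v → c + r * v) (eval-zero cs r cs≡0))
                                  (solve 2 (λ r c → c :+ r :* :0 := c) refl r c)

    quotient-zero : ∀ r cs → IsZero (quotient r cs) → IsZero cs
    quotient-zero r [] _ = []
    quotient-zero r (d ∷ ds) (e ∷ q≡0) = let ds≡0 = quotient-zero r ds q≡0 in
      trans (sym (head≡eval r d ds ds≡0)) e ∷ ds≡0

  roots-bound : ∀ rs cs → ¬ IsZero cs → Unique rs → All (λ r → eval cs r ≡ 0#) rs → length rs < length cs
  roots-bound [] [] cs≢0 _ _ = ⊥-elim (cs≢0 [])
  roots-bound [] (c ∷ cs) _ _ _ = s≤s z≤n
  roots-bound (r ∷ rs) [] cs≢0 _ _ = ⊥-elim (cs≢0 [])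
  roots-bound (r ∷ rs) (c ∷ cs) c∷cs≢0 (r∉rs AllPairs.∷ urs) (r-root ∷ rs-roots) =
      s≤s (subst (length rs <_) (length-quotient r cs) (roots-bound rs (quotient r cs) quotient≢0 urs (All.tabulate roots)))
    where
    quotient≢0 : ¬ IsZero (quotient r cs)
    quotient≢0 q≡0 = let cs≡0 = quotient-zero r cs q≡0 in
      c∷cs≢0 (trans (sym (head≡eval r c cs cs≡0)) r-root ∷ cs≡0)
    roots : ∀ {z} → z ∈ rs → eval (quotient r cs) z ≡ 0#
    roots {z} z∈rs with noZeroDivisors (begin
        (z - r) * eval (quotient r cs) z               ≡⟨ +-identityʳ _ ⟨
        (z - r) * eval (quotient r cs) z + 0#          ≡⟨ cong ((z - r) * eval (quotient r cs) z +_) r-root ⟨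
        (z - r) * eval (quotient r cs) z + eval (c ∷ cs) r ≡⟨ eval-division r z c cs ⟨
        eval (c ∷ cs) z                                ≡⟨ All.lookup rs-roots z∈rs ⟩
        0#                                             ∎)
      where open ≡-Reasoning
    ... | inj₂ e = e
    ... | inj₁ z-r≡0 = ⊥-elim (All.lookup r∉rs z∈rs (sym (x-y≡0⇒x≡y z-r≡0)))

  private
    monomial : ℕ → List Carrier
    monomial zero = 1# ∷ []
    monomial (suc m) = 0# ∷ monomial m

    eval-monomial : ∀ m x → eval (monomial m) x ≡ pow x m
    eval-monomial zero x = solve 1 (λ x → :1 :+ x :* :0 := :1) refl x
    eval-monomial (suc m) x = trans (+-identityˡ _) (cong (x *_) (eval-monomial m x))

    monomial≢0 : ∀ m → ¬ IsZero (monomial m)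
    monomial≢0 zero (1≡0 ∷ _) = 1≢0 1≡0
    monomial≢0 (suc m) (_ ∷ rest≡0) = monomial≢0 m rest≡0

    length-monomial : ∀ m → length (monomial m) ≡ suc m
    length-monomial zero = refl
    length-monomial (suc m) = cong suc (length-monomial m)

  X^[2+m]-X : ℕ → List Carrier
  X^[2+m]-X m = 0# ∷ - 1# ∷ monomial m

  eval-X^[2+m]-X : ∀ m x → eval (X^[2+m]-X m) x ≡ pow x (2 ℕ.+ m) - x
  eval-X^[2+m]-X m x = trans (cong (λ z → 0# + x * (- 1# + x * z)) (eval-monomial m x))
    (solve 2 (λ x z → :0 :+ x :* (:- :1 :+ x :* z) := x :* (x :* z) :- x) refl x (pow x m))

  X^[2+m]-X≢0 : ∀ m → ¬ IsZero (X^[2+m]-X m)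
  X^[2+m]-X≢0 m (_ ∷ _ ∷ rest≡0) = monomial≢0 m rest≡0

  length-X^[2+m]-X : ∀ m → length (X^[2+m]-X m) ≡ 3 ℕ.+ m
  length-X^[2+m]-X m = cong (λ z → suc (suc z)) (length-monomial m)

module QuadraticExtension {q : ℕ} (p k : ℕ) (p-prime : Prime p) (q≡p^k : q ≡ p ℕ.^ k) (2≤q : 2 ≤ q)
                          (F : FiniteField q) (K : FiniteField (q ℕ.* q)) (E : Embedding F K) where

  module F = FieldProperties F
  module K = FieldProperties K
  open Embedding E public

  ι-0 : ι F.0# ≡ K.0#
  ι-0 = K.x+x≈x⇒x≈0 _ (trans (sym (ι-+ F.0# F.0#)) (cong ι (F.+-identityˡ F.0#)))

  ι-neg : ∀ a → ι (F.- a) ≡ K.- ι a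
  ι-neg a = K.x+y≡0⇒x≡-y (trans (sym (ι-+ (F.- a) a)) (trans (cong ι (F.-‿inverseˡ a)) ι-0))

  ι-sub : ∀ a b → ι (a F.- b) ≡ ι a K.- ι b
  ι-sub a b = trans (ι-+ a (F.- b)) (cong (ι a K.+_) (ι-neg b))

  ι-pow : ∀ a n → ι (F.pow a n) ≡ K.pow (ι a) n
  ι-pow a zero = ι-1
  ι-pow a (suc n) = trans (ι-* a _) (cong (ι a K.*_) (ι-pow a n))

  ι-injective : ∀ {a b} → ι a ≡ ι b → a ≡ b
  ι-injective {a} {b} ιa≡ιb with (a F.- b) F.≟ F.0#
  ... | yes a-b≡0 = F.x-y≡0⇒x≡y a-b≡0
  ... | no a-b≢0 = ⊥-elim (K.1≢0 (begin
        K.1#                        ≡⟨ ι-1 ⟨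
        ι F.1#                      ≡⟨ cong ι (proj₂ (F.inverse _ a-b≢0)) ⟨
        ι ((a F.- b) F.* c)         ≡⟨ ι-* _ c ⟩
        ι (a F.- b) K.* ι c         ≡⟨ cong (K._* ι c) (trans (ι-sub a b) (K.x≈y⇒x∙y⁻¹≈ε ιa≡ιb)) ⟩
        K.0# K.* ι c                ≡⟨ K.zeroˡ _ ⟩
        K.0#                        ∎))
    where
    open ≡-Reasoning
    c = proj₁ (F.inverse _ a-b≢0)

  InF : K.Carrier → Set
  InF x = ∃[ a ] ι a ≡ x

  InF? : ∀ x → Dec (InF x)
  InF? x with any? (λ a → ι a K.≟ x) F.elements
  ... | yes found = yes (Any.satisfied found)
  ... | no none = no (λ (a , ιa≡x) → none (Any.map (λ { refl → ιa≡x }) (F.∈-elements a)))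

  characteristic-p : K.fromℕ p ≡ K.0#
  characteristic-p = K.pow≡0⇒≡0 (k ℕ.+ k) (begin
    K.pow (K.fromℕ p) (k ℕ.+ k)   ≡⟨ K.fromℕ-^ p (k ℕ.+ k) ⟨
    K.fromℕ (p ℕ.^ (k ℕ.+ k))     ≡⟨ cong K.fromℕ (trans (ℕ.^-distribˡ-+-* p k k) (sym (cong₂ ℕ._*_ q≡p^k q≡p^k))) ⟩
    K.fromℕ (q ℕ.* q)             ≡⟨ K.characteristic ⟩
    K.0#                          ∎)
    where open ≡-Reasoning

  open FreshmansDream K p-prime characteristic-p

  pow-p^j-+ : ∀ j x y → K.pow (x K.+ y) (p ℕ.^ j) ≡ K.pow x (p ℕ.^ j) K.+ K.pow y (p ℕ.^ j)
  pow-p^j-+ zero x y = trans (K.*-identityʳ _) (sym (cong₂ K._+_ (K.*-identityʳ x) (K.*-identityʳ y)))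
  pow-p^j-+ (suc j) x y = begin
    K.pow (x K.+ y) (p ℕ.* p ℕ.^ j)                   ≡⟨ K.pow-* _ p (p ℕ.^ j) ⟩
    K.pow (K.pow (x K.+ y) p) (p ℕ.^ j)               ≡⟨ cong (λ z → K.pow z (p ℕ.^ j)) (freshmansDream x y) ⟩
    K.pow (K.pow x p K.+ K.pow y p) (p ℕ.^ j)         ≡⟨ pow-p^j-+ j _ _ ⟩
    K.pow (K.pow x p) (p ℕ.^ j) K.+ K.pow (K.pow y p) (p ℕ.^ j)
                                                      ≡⟨ cong₂ K._+_ (K.pow-* x p (p ℕ.^ j)) (K.pow-* y p (p ℕ.^ j)) ⟨
    K.pow x (p ℕ.* p ℕ.^ j) K.+ K.pow y (p ℕ.* p ℕ.^ j) ∎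
    where open ≡-Reasoning

  conj : K.Carrier → K.Carrier
  conj x = K.pow x q

  conj-+ : ∀ x y → conj (x K.+ y) ≡ conj x K.+ conj y
  conj-+ x y = subst (λ n → K.pow (x K.+ y) n ≡ K.pow x n K.+ K.pow y n) (sym q≡p^k) (pow-p^j-+ k x y)

  conj-* : ∀ x y → conj (x K.* y) ≡ conj x K.* conj y
  conj-* x y = K.pow-distrib-* x y q

  conj-0 : conj K.0# ≡ K.0#
  conj-0 = K.x+x≈x⇒x≈0 _ (trans (sym (conj-+ K.0# K.0#)) (cong conj (K.+-identityˡ K.0#)))

  conj-1 : conj K.1# ≡ K.1#
  conj-1 = K.pow-1 q

  conj-pow : ∀ x n → conj (K.pow x n) ≡ K.pow (conj x) n
  conj-pow x zero = conj-1
  conj-pow x (suc n) = trans (conj-* x _) (cong (conj x K.*_) (conj-pow x n))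

  conj-ι : ∀ a → conj (ι a) ≡ ι a
  conj-ι a = trans (sym (ι-pow a q)) (cong ι (F.fermat a))

  conj-involutive : ∀ x → conj (conj x) ≡ x
  conj-involutive x = trans (sym (K.pow-* x q q)) (K.fermat x)

  -- The q elements of F are roots of X^q - X, which has no other roots by the degree bound.
  conj-fixed⇒InF : ∀ x → conj x ≡ x → InF x
  conj-fixed⇒InF x conj-x≡x with InF? x
  ... | yes x∈F = x∈F
  ... | no x∉F = ⊥-elim (ℕ.<-irrefl refl (ℕ.<-≤-trans
          (KP.roots-bound (x ∷ map ι F.elements) (KP.X^[2+m]-X (q ∸ 2)) (KP.X^[2+m]-X≢0 (q ∸ 2)) distinct roots)
          (ℕ.≤-reflexive (trans (KP.length-X^[2+m]-X (q ∸ 2)) (cong suc (trans 2+[q∸2]≡q (sym |roots|≡q)))))))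
    where
    module KP = Polynomials K
    2+[q∸2]≡q : 2 ℕ.+ (q ∸ 2) ≡ q
    2+[q∸2]≡q = ℕ.m+[n∸m]≡n 2≤q
    |roots|≡q : length (map ι F.elements) ≡ q
    |roots|≡q = trans (length-map ι F.elements) F.length-elements
    root : ∀ {y} → conj y ≡ y → KP.eval (KP.X^[2+m]-X (q ∸ 2)) y ≡ K.0#
    root {y} conj-y≡y = trans (KP.eval-X^[2+m]-X (q ∸ 2) y) (K.x≈y⇒x∙y⁻¹≈ε (trans (cong (K.pow y) 2+[q∸2]≡q) conj-y≡y))
    roots : All (λ r → KP.eval (KP.X^[2+m]-X (q ∸ 2)) r ≡ K.0#) (x ∷ map ι F.elements)
    roots = root conj-x≡x ∷ All.tabulate λ y∈ → let a , _ , y≡ιa = ∈-map⁻ ι y∈ in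
      root (trans (cong conj y≡ιa) (trans (conj-ι a) (sym y≡ιa)))
    distinct : Unique (x ∷ map ι F.elements)
    distinct = Unique-∷ (λ x∈ → let a , _ , x≡ιa = ∈-map⁻ ι x∈ in x∉F (a , sym x≡ιa))
                        (Unique.map⁺ ι-injective F.elements-unique)

⟨⟩-cong : ∀ {A : Set} {a b c d a′ b′ c′ d′ : A} →
          a ≡ a′ → b ≡ b′ → c ≡ c′ → d ≡ d′ → ⟨ a , b , c , d ⟩ ≡ ⟨ a′ , b′ , c′ , d′ ⟩
⟨⟩-cong refl refl refl refl = refl

module TwistedCubicGeometry {q : ℕ} (p k : ℕ) (p-prime : Prime p) (q≡p^k : q ≡ p ℕ.^ k) (2≤q : 2 ≤ q)
                            (F : FiniteField q) (K : FiniteField (q ℕ.* q)) (E : Embedding F K) where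

  open QuadraticExtension p k p-prime q≡p^k 2≤q F K E public
  open TwistedCubic F K E public hiding (module K)

  _·K_ : V4 K.Carrier → V4 K.Carrier → K.Carrier
  ⟨ a , b , c , d ⟩ ·K ⟨ x , y , z , w ⟩ = a K.* x K.+ b K.* y K.+ c K.* z K.+ d K.* w

  -- c₀t³ + c₁t² + c₂t + c₃ over F_{q²} for π = π(c₀,c₁,c₂,c₃); it vanishes at t iff P(t) lies on π.
  cubic : Vec4 → K.Carrier → K.Carrier
  cubic π t = map4 ι π ·K PK t

  ι-· : ∀ π X → ι (π · X) ≡ map4 ι π ·K map4 ι X
  ι-· ⟨ a , b , c , d ⟩ ⟨ x , y , z , w ⟩ =
    trans (ι-+ _ _) (cong₂ K._+_ (trans (ι-+ _ _) (cong₂ K._+_ (trans (ι-+ _ _) (cong₂ K._+_ (ι-* a x) (ι-* b y))) (ι-* c z))) (ι-* d w))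

  ·K-linear : ∀ C a U b V → C ·K (scaleK a U +K4 scaleK b V) ≡ a K.* (C ·K U) K.+ b K.* (C ·K V)
  ·K-linear ⟨ c₀ , c₁ , c₂ , c₃ ⟩ a ⟨ u₀ , u₁ , u₂ , u₃ ⟩ b ⟨ v₀ , v₁ , v₂ , v₃ ⟩ =
    K.solve 14 (λ c₀ c₁ c₂ c₃ a u₀ u₁ u₂ u₃ b v₀ v₁ v₂ v₃ →
       c₀ :* (a :* u₀ :+ b :* v₀) :+ c₁ :* (a :* u₁ :+ b :* v₁) :+ c₂ :* (a :* u₂ :+ b :* v₂) :+ c₃ :* (a :* u₃ :+ b :* v₃)
       := a :* (c₀ :* u₀ :+ c₁ :* u₁ :+ c₂ :* u₂ :+ c₃ :* u₃) :+ b :* (c₀ :* v₀ :+ c₁ :* v₁ :+ c₂ :* v₂ :+ c₃ :* v₃))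
      refl c₀ c₁ c₂ c₃ a u₀ u₁ u₂ u₃ b v₀ v₁ v₂ v₃
    where open K using (_:+_; _:*_; _:=_)

  cubic≡0⇒ContainsChord : ∀ π s → cubic π s ≡ K.0# → cubic π (conj s) ≡ K.0# → ContainsChord π s
  cubic≡0⇒ContainsChord π s πs≡0 πs̄≡0 X _ (a , b , X≡aPs+bPs̄) = ι-injective (begin
    ι (π · X)                                          ≡⟨ ι-· π X ⟩
    map4 ι π ·K map4 ι X                               ≡⟨ cong (map4 ι π ·K_) X≡aPs+bPs̄ ⟩
    map4 ι π ·K (scaleK a (PK s) +K4 scaleK b (PK (conj s)))
                                                       ≡⟨ ·K-linear (map4 ι π) a (PK s) b (PK (conj s)) ⟩
    a K.* cubic π s K.+ b K.* cubic π (conj s)         ≡⟨ cong₂ (λ u v → a K.* u K.+ b K.* v) πs≡0 πs̄≡0 ⟩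
    a K.* K.0# K.+ b K.* K.0#                          ≡⟨ K.solve 2 (λ a b → a K.:* K.:0 K.:+ b K.:* K.:0 K.:= K.:0) refl a b ⟩
    K.0#                                               ≡⟨ ι-0 ⟨
    ι F.0#                                             ∎)
    where open ≡-Reasoning

  conj-cubic : ∀ π t → conj (cubic π t) ≡ cubic π (conj t)
  conj-cubic ⟨ a , b , c , d ⟩ t =
    trans (conj-+ _ _) (cong₂ K._+_ (trans (conj-+ _ _) (cong₂ K._+_ (trans (conj-+ _ _)
      (cong₂ K._+_ (conj-ι* a (K.pow t 3) (conj-pow t 3)) (conj-ι* b (K.pow t 2) (conj-pow t 2))))
      (conj-ι* c t refl))) (conj-ι* d K.1# conj-1))
    where
    conj-ι* : ∀ a u {v} → conj u ≡ v → conj (ι a K.* u) ≡ ι a K.* v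
    conj-ι* a u conj-u≡v = trans (conj-* (ι a) u) (cong₂ K._*_ (conj-ι a) conj-u≡v)

  ·-scale : ∀ π μ X → π · scale μ X ≡ μ F.* (π · X)
  ·-scale ⟨ a , b , c , d ⟩ μ ⟨ x , y , z , w ⟩ =
    F.solve 9 (λ a b c d μ x y z w →
      a :* (μ :* x) :+ b :* (μ :* y) :+ c :* (μ :* z) :+ d :* (μ :* w) := μ :* (a :* x :+ b :* y :+ c :* z :+ d :* w))
      refl a b c d μ x y z w
    where open F using (_:+_; _:*_; _:=_)

  zero4 : Vec4
  zero4 = ⟨ F.0# , F.0# , F.0# , F.0# ⟩

  private
    scaledToOne : ∀ {x} {N : F.Carrier → Set} → x ≢ F.0# → (∀ μ → μ F.* x ≡ F.1# → N μ) → ∃[ μ ] (μ ≢ F.0# × N μ)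
    scaledToOne {x} x≢0 N-of =
      let μ , xμ≡1 = F.inverse x x≢0 in μ , F.x*y≡1⇒y≢0 xμ≡1 , N-of μ (trans (F.*-comm μ x) xμ≡1)

  normalize : ∀ X → X ≢ zero4 → ∃[ μ ] (μ ≢ F.0# × Normalized (scale μ X))
  normalize ⟨ a , b , c , d ⟩ X≢0 with a F.≟ F.0# | b F.≟ F.0# | c F.≟ F.0# | d F.≟ F.0#
  ... | no a≢0 | _ | _ | _ = scaledToOne a≢0 (λ μ → inj₁)
  ... | yes refl | no b≢0 | _ | _ = scaledToOne b≢0 (λ μ μb≡1 → inj₂ (inj₁ (F.zeroʳ μ , μb≡1)))
  ... | yes refl | yes refl | no c≢0 | _ = scaledToOne c≢0 (λ μ μc≡1 → inj₂ (inj₂ (inj₁ (F.zeroʳ μ , F.zeroʳ μ , μc≡1))))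
  ... | yes refl | yes refl | yes refl | no d≢0 =
    scaledToOne d≢0 (λ μ μd≡1 → inj₂ (inj₂ (inj₂ (F.zeroʳ μ , F.zeroʳ μ , F.zeroʳ μ , μd≡1))))
  ... | yes refl | yes refl | yes refl | yes refl = ⊥-elim (X≢0 refl)

  ι-scale : ∀ μ X → map4 ι (scale μ X) ≡ scaleK (ι μ) (map4 ι X)
  ι-scale μ ⟨ a , b , c , d ⟩ = ⟨⟩-cong (ι-* μ a) (ι-* μ b) (ι-* μ c) (ι-* μ d)

  scaleK-distrib : ∀ m a U b V → scaleK m (scaleK a U +K4 scaleK b V) ≡ scaleK (m K.* a) U +K4 scaleK (m K.* b) V
  scaleK-distrib m a ⟨ u₀ , u₁ , u₂ , u₃ ⟩ b ⟨ v₀ , v₁ , v₂ , v₃ ⟩ =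
    ⟨⟩-cong (distrib u₀ v₀) (distrib u₁ v₁) (distrib u₂ v₂) (distrib u₃ v₃)
    where
    open K using (_:+_; _:*_; _:=_)
    distrib : ∀ u v → m K.* (a K.* u K.+ b K.* v) ≡ m K.* a K.* u K.+ m K.* b K.* v
    distrib = K.solve 5 (λ m a b u v → m :* (a :* u :+ b :* v) := m :* a :* u :+ m :* b :* v) refl m a b

  Imaginary⇒conj≢ : ∀ {s} → Imaginary s → conj s ≢ s
  Imaginary⇒conj≢ s∉F conj-s≡s = s∉F (conj-fixed⇒InF _ conj-s≡s)

  Imaginary-conj : ∀ {s} → Imaginary s → Imaginary (conj s)
  Imaginary-conj {s} s∉F (a , ιa≡s̄) = s∉F (a , trans (sym (conj-ι a)) (trans (cong conj ιa≡s̄) (conj-involutive s)))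

  Imaginary⇒≢0 : ∀ {s} → Imaginary s → s ≢ K.0#
  Imaginary⇒≢0 s∉F s≡0 = s∉F (F.0# , trans ι-0 (sym s≡0))

  Imaginary⇒independent : ∀ {s} → Imaginary s → ∀ a b → ι a K.* s K.+ ι b ≡ K.0# → a ≡ F.0# × b ≡ F.0#
  Imaginary⇒independent {s} s∉F a b ιa*s+ιb≡0 with a F.≟ F.0#
  ... | yes refl = refl , ι-injective (begin
      ι b                    ≡⟨ K.solve 2 (λ s b → b K.:= K.:0 K.:* s K.:+ b) refl s (ι b) ⟩
      K.0# K.* s K.+ ι b     ≡⟨ cong (λ z → z K.* s K.+ ι b) ι-0 ⟨
      ι F.0# K.* s K.+ ι b   ≡⟨ ιa*s+ιb≡0 ⟩
      K.0#                   ≡⟨ ι-0 ⟨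
      ι F.0#                 ∎)
    where open ≡-Reasoning
  ... | no a≢0 = ⊥-elim (s∉F (F.- (b F.* a⁻¹) , (begin
      ι (F.- (b F.* a⁻¹))                   ≡⟨ trans (ι-neg _) (cong K.-_ (ι-* b a⁻¹)) ⟩
      K.- (ι b K.* ι a⁻¹)                   ≡⟨ cong (λ z → K.- (z K.* ι a⁻¹)) (K.x+y≡0⇒x≡-y (trans (K.+-comm _ _) ιa*s+ιb≡0)) ⟩
      K.- (K.- (ι a K.* s) K.* ι a⁻¹)       ≡⟨ K.solve 3 (λ A s I → :- ((:- (A :* s)) :* I) := s :* (A :* I)) refl (ι a) s (ι a⁻¹) ⟩
      s K.* (ι a K.* ι a⁻¹)                 ≡⟨ cong (s K.*_) (trans (sym (ι-* a a⁻¹)) (trans (cong ι aa⁻¹≡1) ι-1)) ⟩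
      s K.* K.1#                            ≡⟨ K.*-identityʳ s ⟩
      s                                     ∎)))
    where
    open ≡-Reasoning
    open K using (_:*_; :-_; _:=_)
    a⁻¹ = proj₁ (F.inverse a a≢0)
    aa⁻¹≡1 : a F.* a⁻¹ ≡ F.1#
    aa⁻¹≡1 = proj₂ (F.inverse a a≢0)

  -- c·P(s) + c^q·P(s^q) is fixed by conjugation, so it is an F_q-rational point of the chord.
  module ChordPoint (s c : K.Carrier) where

    private
      conj-invariant : ∀ A B → conj A ≡ B → conj B ≡ A → conj (c K.* A K.+ conj c K.* B) ≡ c K.* A K.+ conj c K.* B
      conj-invariant A B Ā≡B B̄≡A = trans (conj-+ _ _) (trans (cong₂ K._+_ (trans (conj-* c A) (cong (conj c K.*_) Ā≡B))
         (trans (conj-* (conj c) B) (cong₂ K._*_ (conj-involutive c) B̄≡A))) (K.+-comm _ _))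

      conj-pow-conj : ∀ n → conj (K.pow (conj s) n) ≡ K.pow s n
      conj-pow-conj n = trans (conj-pow (conj s) n) (cong (λ z → K.pow z n) (conj-involutive s))

      coordinate : ∀ A B → conj A ≡ B → conj B ≡ A → F.Carrier
      coordinate A B Ā≡B B̄≡A = proj₁ (conj-fixed⇒InF _ (conj-invariant A B Ā≡B B̄≡A))

      ι-coordinate : ∀ A B Ā≡B B̄≡A → ι (coordinate A B Ā≡B B̄≡A) ≡ c K.* A K.+ conj c K.* B
      ι-coordinate A B Ā≡B B̄≡A = proj₂ (conj-fixed⇒InF _ (conj-invariant A B Ā≡B B̄≡A))

    point : Vec4
    point = ⟨ coordinate _ _ (conj-pow s 3) (conj-pow-conj 3) , coordinate _ _ (conj-pow s 2) (conj-pow-conj 2)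
            , coordinate _ _ refl (conj-involutive s) , coordinate _ _ conj-1 conj-1 ⟩

    ι-point : map4 ι point ≡ scaleK c (PK s) +K4 scaleK (conj c) (PK (conj s))
    ι-point = ⟨⟩-cong (ι-coordinate _ _ _ _) (ι-coordinate _ _ _ _) (ι-coordinate _ _ _ _) (ι-coordinate _ _ _ _)

    point≡0⇒c[s-s̄]≡0 : point ≡ zero4 → c K.* (s K.- conj s) ≡ K.0#
    point≡0⇒c[s-s̄]≡0 point≡0 = begin
      c K.* (s K.- conj s)                                                    ≡⟨ K.solve 4 (λ c c̄ s s̄ →
          c :* (s :- s̄) := (c :* s :+ c̄ :* s̄) :- s̄ :* (c :* :1 :+ c̄ :* :1)) refl c (conj c) s (conj s) ⟩
      (c K.* s K.+ conj c K.* conj s) K.- conj s K.* (c K.* K.1# K.+ conj c K.* K.1#)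
                                                                              ≡⟨ cong₂ (λ u v → u K.- conj s K.* v) c₂≡0 c₃≡0 ⟩
      K.0# K.- conj s K.* K.0#                                                ≡⟨ K.solve 1 (λ s̄ → :0 :- s̄ :* :0 := :0) refl (conj s) ⟩
      K.0#                                                                    ∎
      where
      open ≡-Reasoning
      open K using (_:+_; _:*_; _:-_; _:=_; :0; :1)
      ι-point≡0 : map4 ι point ≡ map4 ι zero4
      ι-point≡0 = cong (map4 ι) point≡0
      c₂≡0 : c K.* s K.+ conj c K.* conj s ≡ K.0#
      c₂≡0 = trans (cong V4.c2 (sym ι-point)) (trans (cong V4.c2 ι-point≡0) ι-0)
      c₃≡0 : c K.* K.1# K.+ conj c K.* K.1# ≡ K.0#
      c₃≡0 = trans (cong V4.c3 (sym ι-point)) (trans (cong V4.c3 ι-point≡0) ι-0)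

    on-chord : ∀ μ → OnChord s (scale μ point)
    on-chord μ = ι μ K.* c , ι μ K.* conj c , (begin
      map4 ι (scale μ point)                                        ≡⟨ ι-scale μ point ⟩
      scaleK (ι μ) (map4 ι point)                                   ≡⟨ cong (scaleK (ι μ)) ι-point ⟩
      scaleK (ι μ) (scaleK c (PK s) +K4 scaleK (conj c) (PK (conj s)))
                                                                    ≡⟨ scaleK-distrib (ι μ) c (PK s) (conj c) (PK (conj s)) ⟩
      scaleK (ι μ K.* c) (PK s) +K4 scaleK (ι μ K.* conj c) (PK (conj s)) ∎)
      where open ≡-Reasoning

  ContainsChord⇒chordPointEquation : ∀ π s c → ContainsChord π s → ChordPoint.point s c ≢ zero4 →
                             c K.* cubic π s K.+ conj c K.* cubic π (conj s) ≡ K.0#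
  ContainsChord⇒chordPointEquation π s c π⊇chord X≢0 = begin
    c K.* cubic π s K.+ conj c K.* cubic π (conj s)   ≡⟨ ·K-linear (map4 ι π) c (PK s) (conj c) (PK (conj s)) ⟨
    map4 ι π ·K (scaleK c (PK s) +K4 scaleK (conj c) (PK (conj s)))
                                                      ≡⟨ cong (map4 ι π ·K_) ι-point ⟨
    map4 ι π ·K map4 ι point                          ≡⟨ ι-· π point ⟨
    ι (π · point)                                     ≡⟨ cong ι π·X≡0 ⟩
    ι F.0#                                            ≡⟨ ι-0 ⟩
    K.0#                                              ∎
    where
    open ≡-Reasoning
    open ChordPoint s c
    μ = proj₁ (normalize point X≢0)
    μ≢0 : μ ≢ F.0#
    μ≢0 = proj₁ (proj₂ (normalize point X≢0))
    π·X≡0 : π · point ≡ F.0#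
    π·X≡0 = F.*-cancelˡ-0 μ≢0 (trans (sym (·-scale π μ point)) (π⊇chord (scale μ point) (proj₂ (proj₂ (normalize point X≢0))) (on-chord μ)))

  -- The chord points for c = 1 and c = s give two independent linear equations in cubic π s and cubic π s^q.
  ContainsChord⇒cubic≡0 : ∀ π s → Imaginary s → ContainsChord π s → cubic π s ≡ K.0#
  ContainsChord⇒cubic≡0 π s s∉F π⊇chord = K.*-cancelˡ-0 s-s̄≢0 (begin
    (s K.- conj s) K.* f                                       ≡⟨ K.solve 4 (λ s s̄ f f̄ →
          (s :- s̄) :* f := (s :* f :+ s̄ :* f̄) :- s̄ :* (:1 :* f :+ :1 :* f̄)) refl s (conj s) f f̄ ⟩
    (s K.* f K.+ conj s K.* f̄) K.- conj s K.* (K.1# K.* f K.+ K.1# K.* f̄)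
                                                               ≡⟨ cong₂ (λ u v → u K.- conj s K.* v) at-s at-1 ⟩
    K.0# K.- conj s K.* K.0#                                   ≡⟨ K.solve 1 (λ s̄ → :0 :- s̄ :* :0 := :0) refl (conj s) ⟩
    K.0#                                                       ∎)
    where
    open ≡-Reasoning
    open K using (_:+_; _:*_; _:-_; _:=_; :0; :1)
    f = cubic π s
    f̄ = cubic π (conj s)
    s-s̄≢0 : s K.- conj s ≢ K.0#
    s-s̄≢0 s-s̄≡0 = Imaginary⇒conj≢ s∉F (sym (K.x-y≡0⇒x≡y s-s̄≡0))
    at-1 : K.1# K.* f K.+ K.1# K.* f̄ ≡ K.0#
    at-1 = trans (cong (λ z → K.1# K.* f K.+ z K.* f̄) (sym conj-1))
      (ContainsChord⇒chordPointEquation π s K.1# π⊇chord (λ X≡0 → s-s̄≢0 (trans (sym (K.*-identityˡ _)) (ChordPoint.point≡0⇒c[s-s̄]≡0 s K.1# X≡0))))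
    at-s : s K.* f K.+ conj s K.* f̄ ≡ K.0#
    at-s = ContainsChord⇒chordPointEquation π s s π⊇chord (λ X≡0 → K.*-nonzero (Imaginary⇒≢0 s∉F) s-s̄≢0 (ChordPoint.point≡0⇒c[s-s̄]≡0 s s X≡0))

  ι-cubic : ∀ π v → ι (π · P (just v)) ≡ cubic π (ι v)
  ι-cubic π v = trans (ι-· π (P (just v))) (cong (map4 ι π ·K_) (⟨⟩-cong (ι-pow v 3) (ι-pow v 2) refl ι-1))

  cubic≡0⇒∈π : ∀ π v → cubic π (ι v) ≡ K.0# → P (just v) ∈π π
  cubic≡0⇒∈π π v πv≡0 = ι-injective (trans (ι-cubic π v) (trans πv≡0 (sym ι-0)))

  ∈π⇒cubic≡0 : ∀ π v → P (just v) ∈π π → cubic π (ι v) ≡ K.0#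
  ∈π⇒cubic≡0 π v v∈π = trans (sym (ι-cubic π v)) (trans (cong ι v∈π) ι-0)

  private
    ·K-scaleˡ : ∀ m U W → scaleK m U ·K W ≡ m K.* (U ·K W)
    ·K-scaleˡ m ⟨ a , b , c , d ⟩ ⟨ x , y , z , w ⟩ =
      K.solve 9 (λ m a b c d x y z w → m :* a :* x :+ m :* b :* y :+ m :* c :* z :+ m :* d :* w
                                       := m :* (a :* x :+ b :* y :+ c :* z :+ d :* w)) refl m a b c d x y z w
      where open K using (_:+_; _:*_; _:=_)

    ι-3 : ι F.3# ≡ K.3#
    ι-3 = trans (ι-+ _ _) (cong₂ K._+_ (trans (ι-+ _ _) (cong₂ K._+_ ι-1 ι-1)) ι-1)

    cubic-scale : ∀ c X t → cubic (scale c X) t ≡ ι c K.* cubic X t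
    cubic-scale c X t = trans (cong (_·K PK t) (ι-scale c X)) (·K-scaleˡ (ι c) (map4 ι X) (PK t))

    cubic-osc : ∀ v t → cubic (osc (just v)) t ≡ K.pow (t K.- ι v) 3
    cubic-osc v t = begin
      ι F.1# K.* K.pow t 3 K.+ ι (F.- (F.3# F.* v)) K.* K.pow t 2 K.+ ι (F.3# F.* F.pow v 2) K.* t K.+ ι (F.- F.pow v 3) K.* K.1#
        ≡⟨ cong₂ (λ a b → a K.* K.pow t 3 K.+ b K.* K.pow t 2 K.+ ι (F.3# F.* F.pow v 2) K.* t K.+ ι (F.- F.pow v 3) K.* K.1#)
             ι-1 (trans (ι-neg _) (cong K.-_ (trans (ι-* _ v) (cong (K._* V) ι-3)))) ⟩
      K.1# K.* K.pow t 3 K.+ K.- (K.3# K.* V) K.* K.pow t 2 K.+ ι (F.3# F.* F.pow v 2) K.* t K.+ ι (F.- F.pow v 3) K.* K.1#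
        ≡⟨ cong₂ (λ a b → K.1# K.* K.pow t 3 K.+ K.- (K.3# K.* V) K.* K.pow t 2 K.+ a K.* t K.+ b K.* K.1#)
             (trans (ι-* _ _) (cong₂ K._*_ ι-3 (ι-pow v 2))) (trans (ι-neg _) (cong K.-_ (ι-pow v 3))) ⟩
      K.1# K.* K.pow t 3 K.+ K.- (K.3# K.* V) K.* K.pow t 2 K.+ (K.3# K.* K.pow V 2) K.* t K.+ K.- K.pow V 3 K.* K.1#
        ≡⟨ K.solve 2 (λ t V → :1 :* (t :* (t :* (t :* :1))) :+ :- ((:1 :+ :1 :+ :1) :* V) :* (t :* (t :* :1))
                              :+ ((:1 :+ :1 :+ :1) :* (V :* (V :* :1))) :* t :+ :- (V :* (V :* (V :* :1))) :* :1
                              := (t :- V) :* ((t :- V) :* ((t :- V) :* :1))) refl t V ⟩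
      K.pow (t K.- V) 3 ∎
      where
      open ≡-Reasoning
      open K using (_:+_; _:*_; _:-_; :-_; _:=_; :1)
      V = ι v

    cubic-osc-∞ : ∀ t → cubic (osc nothing) t ≡ K.1#
    cubic-osc-∞ t = begin
      ι F.0# K.* K.pow t 3 K.+ ι F.0# K.* K.pow t 2 K.+ ι F.0# K.* t K.+ ι F.1# K.* K.1#
        ≡⟨ cong₂ (λ a b → a K.* K.pow t 3 K.+ a K.* K.pow t 2 K.+ a K.* t K.+ b K.* K.1#) ι-0 ι-1 ⟩
      K.0# K.* K.pow t 3 K.+ K.0# K.* K.pow t 2 K.+ K.0# K.* t K.+ K.1# K.* K.1#
        ≡⟨ K.solve 1 (λ t → :0 :* (t :* (t :* (t :* :1))) :+ :0 :* (t :* (t :* :1)) :+ :0 :* t :+ :1 :* :1 := :1) refl t ⟩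
      K.1# ∎
      where
      open ≡-Reasoning
      open K using (_:+_; _:*_; _:=_; :0; :1)

  -- The cubic of an osculating plane is a constant or a cube (t - v)³ with v ∈ F_q, so it has no imaginary root.
  cubic≡0⇒¬ΓPlane : ∀ π t → Imaginary t → cubic π t ≡ K.0# → ¬ ΓPlane π
  cubic≡0⇒¬ΓPlane π t t∉F πt≡0 (just v , c , c≢0 , refl) =
    t∉F (v , sym (K.x-y≡0⇒x≡y (K.pow≡0⇒≡0 3 (K.*-cancelˡ-0 ιc≢0 (trans (sym cubic≡c[t-v]³) πt≡0)))))
    where
    cubic≡c[t-v]³ : cubic (scale c (osc (just v))) t ≡ ι c K.* K.pow (t K.- ι v) 3
    cubic≡c[t-v]³ = trans (cubic-scale c _ t) (cong (ι c K.*_) (cubic-osc v t))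
    ιc≢0 : ι c ≢ K.0#
    ιc≢0 ιc≡0 = c≢0 (ι-injective (trans ιc≡0 (sym ι-0)))
  cubic≡0⇒¬ΓPlane π t t∉F πt≡0 (nothing , c , c≢0 , refl) = c≢0 (ι-injective (begin
    ι c                                ≡⟨ K.*-identityʳ (ι c) ⟨
    ι c K.* K.1#                       ≡⟨ cong (ι c K.*_) (cubic-osc-∞ t) ⟨
    ι c K.* cubic (osc nothing) t      ≡⟨ cubic-scale c (osc nothing) t ⟨
    cubic (scale c (osc nothing)) t    ≡⟨ πt≡0 ⟩
    K.0#                               ≡⟨ ι-0 ⟨
    ι F.0#                             ∎))
    where open ≡-Reasoning

module Pencils {q : ℕ} (p k : ℕ) (p-prime : Prime p) (q≡p^k : q ≡ p ℕ.^ k) (2≤q : 2 ≤ q)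
               (F : FiniteField q) (K : FiniteField (q ℕ.* q)) (E : Embedding F K) where

  open TwistedCubicGeometry p k p-prime q≡p^k 2≤q F K E public

  _−₄_ : Vec4 → Vec4 → Vec4
  ⟨ a , b , c , d ⟩ −₄ ⟨ x , y , z , w ⟩ = ⟨ a F.- x , b F.- y , c F.- z , d F.- w ⟩

  cubic-sub : ∀ π π′ t → cubic (π −₄ π′) t ≡ cubic π t K.- cubic π′ t
  cubic-sub ⟨ a , b , c , d ⟩ ⟨ x , y , z , w ⟩ t =
    trans (cong₂ (λ u v → u K.* K.pow t 3 K.+ v K.* K.pow t 2 K.+ ι (c F.- z) K.* t K.+ ι (d F.- w) K.* K.1#) (ι-sub a x) (ι-sub b y))
    (trans (cong₂ (λ u v → (ι a K.- ι x) K.* K.pow t 3 K.+ (ι b K.- ι y) K.* K.pow t 2 K.+ u K.* t K.+ v K.* K.1#) (ι-sub c z) (ι-sub d w))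
      (K.solve 11 (λ a b c d x y z w t³ t² t → (a :- x) :* t³ :+ (b :- y) :* t² :+ (c :- z) :* t :+ (d :- w) :* :1
                 := (a :* t³ :+ b :* t² :+ c :* t :+ d :* :1) :- (x :* t³ :+ y :* t² :+ z :* t :+ w :* :1))
        refl (ι a) (ι b) (ι c) (ι d) (ι x) (ι y) (ι z) (ι w) (K.pow t 3) (K.pow t 2) t))
    where open K using (_:+_; _:*_; _:-_; _:=_; :1)

  cubic-linear : ∀ r₁ r₀ t → cubic ⟨ F.0# , F.0# , r₁ , r₀ ⟩ t ≡ ι r₁ K.* t K.+ ι r₀
  cubic-linear r₁ r₀ t = trans (cong (λ z → z K.* K.pow t 3 K.+ z K.* K.pow t 2 K.+ ι r₁ K.* t K.+ ι r₀ K.* K.1#) ι-0)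
    (K.solve 5 (λ t³ t² t r₁ r₀ → :0 :* t³ :+ :0 :* t² :+ r₁ :* t :+ r₀ :* :1 := r₁ :* t :+ r₀) refl (K.pow t 3) (K.pow t 2) t (ι r₁) (ι r₀))
    where open K using (_:+_; _:*_; _:=_; :0; :1)

  module Chord (s : K.Carrier) where

    private
      conj-trace : conj (s K.+ conj s) ≡ s K.+ conj s
      conj-trace = trans (conj-+ s (conj s)) (trans (cong (conj s K.+_) (conj-involutive s)) (K.+-comm _ _))

      conj-norm : conj (s K.* conj s) ≡ s K.* conj s
      conj-norm = trans (conj-* s (conj s)) (trans (cong (conj s K.*_) (conj-involutive s)) (K.*-comm _ _))

    -- Kept abstract: only the two equations below matter, and unfolding the witnesses is expensive.
    abstract
      trace norm : F.Carrier
      trace = proj₁ (conj-fixed⇒InF _ conj-trace)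
      norm = proj₁ (conj-fixed⇒InF _ conj-norm)

      ι-trace : ι trace ≡ s K.+ conj s
      ι-trace = proj₂ (conj-fixed⇒InF _ conj-trace)

      ι-norm : ι norm ≡ s K.* conj s
      ι-norm = proj₂ (conj-fixed⇒InF _ conj-norm)

    minpoly : K.Carrier → K.Carrier
    minpoly t = t K.* t K.- ι trace K.* t K.+ ι norm

    minpoly-factors : ∀ t → minpoly t ≡ (t K.- s) K.* (t K.- conj s)
    minpoly-factors t = trans (cong₂ (λ a b → t K.* t K.- a K.* t K.+ b) ι-trace ι-norm)
      (K.solve 3 (λ t s s̄ → t :* t :- (s :+ s̄) :* t :+ s :* s̄ := (t :- s) :* (t :- s̄)) refl t s (conj s))
      where open K using (_:+_; _:*_; _:-_; _:=_)

    minpoly-s : minpoly s ≡ K.0#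
    minpoly-s = trans (minpoly-factors s) (trans (cong (K._* (s K.- conj s)) (K.-‿inverseʳ s)) (K.zeroˡ _))

    minpoly-conj : minpoly (conj s) ≡ K.0#
    minpoly-conj = trans (minpoly-factors (conj s)) (trans (cong ((conj s K.- s) K.*_) (K.-‿inverseʳ (conj s))) (K.zeroʳ _))

    minpoly-roots : ∀ t → minpoly t ≡ K.0# → t ≡ s ⊎ t ≡ conj s
    minpoly-roots t minpoly-t≡0 with K.noZeroDivisors (trans (sym (minpoly-factors t)) minpoly-t≡0)
    ... | inj₁ t-s≡0 = inj₁ (K.x-y≡0⇒x≡y t-s≡0)
    ... | inj₂ t-s̄≡0 = inj₂ (K.x-y≡0⇒x≡y t-s̄≡0)

    minpoly-ι≢0 : Imaginary s → ∀ v → minpoly (ι v) ≢ K.0#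
    minpoly-ι≢0 s∉F v minpoly-v≡0 with minpoly-roots (ι v) minpoly-v≡0
    ... | inj₁ ιv≡s = s∉F (v , ιv≡s)
    ... | inj₂ ιv≡s̄ = Imaginary-conj s∉F (v , ιv≡s̄)

    pencilPlane : F.Carrier → F.Carrier → Vec4
    pencilPlane a b = ⟨ a , b F.- a F.* trace , a F.* norm F.- b F.* trace , b F.* norm ⟩

    cubic-pencilPlane : ∀ a b t → cubic (pencilPlane a b) t ≡ minpoly t K.* (ι a K.* t K.+ ι b)
    cubic-pencilPlane a b t = begin
      cubic (pencilPlane a b) t
        ≡⟨ cong₂ (λ u v → ι a K.* K.pow t 3 K.+ u K.* K.pow t 2 K.+ v K.* t K.+ ι (b F.* norm) K.* K.1#)
             (trans (ι-sub _ _) (cong (λ z → ι b K.- z) (ι-* a trace)))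
             (trans (ι-sub _ _) (cong₂ K._-_ (ι-* a norm) (ι-* b trace))) ⟩
      ι a K.* K.pow t 3 K.+ (ι b K.- ι a K.* S) K.* K.pow t 2 K.+ (ι a K.* N K.- ι b K.* S) K.* t K.+ ι (b F.* norm) K.* K.1#
        ≡⟨ cong (λ u → ι a K.* K.pow t 3 K.+ (ι b K.- ι a K.* S) K.* K.pow t 2 K.+ (ι a K.* N K.- ι b K.* S) K.* t K.+ u K.* K.1#) (ι-* b norm) ⟩
      ι a K.* K.pow t 3 K.+ (ι b K.- ι a K.* S) K.* K.pow t 2 K.+ (ι a K.* N K.- ι b K.* S) K.* t K.+ (ι b K.* N) K.* K.1#
        ≡⟨ K.solve 5 (λ t a b S N → a :* (t :* (t :* (t :* :1))) :+ (b :- a :* S) :* (t :* (t :* :1)) :+ (a :* N :- b :* S) :* t :+ (b :* N) :* :1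
                                    := (t :* t :- S :* t :+ N) :* (a :* t :+ b)) refl t (ι a) (ι b) S N ⟩
      minpoly t K.* (ι a K.* t K.+ ι b) ∎
      where
      open ≡-Reasoning
      open K using (_:+_; _:*_; _:-_; _:=_; :1)
      S = ι trace
      N = ι norm

    -- Dividing the cubic of π by minpoly leaves a remainder r₁t + r₀ over F_q, which must vanish at the imaginary s.
    cubic≡0⇒pencilPlane : Imaginary s → ∀ π → cubic π s ≡ K.0# → π ≡ pencilPlane (V4.c0 π) (V4.c1 π F.+ V4.c0 π F.* trace)
    cubic≡0⇒pencilPlane s∉F π@(⟨ c₀ , c₁ , c₂ , c₃ ⟩) πs≡0 = ⟨⟩-cong refl
        (F.solve 2 (λ c₁ c₀σ → c₁ := (c₁ :+ c₀σ) :- c₀σ) refl c₁ (c₀ F.* trace))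
        (F.x-y≡0⇒x≡y (proj₁ remainder≡0)) (F.x-y≡0⇒x≡y (proj₂ remainder≡0))
      where
      open F using (_:+_; _:-_; _:=_)
      β = c₁ F.+ c₀ F.* trace
      π′ = pencilPlane c₀ β
      remainder≡0 : c₂ F.- V4.c2 π′ ≡ F.0# × c₃ F.- V4.c3 π′ ≡ F.0#
      remainder≡0 = Imaginary⇒independent s∉F _ _ (begin
        ι (c₂ F.- V4.c2 π′) K.* s K.+ ι (c₃ F.- V4.c3 π′)   ≡⟨ cubic-linear _ _ s ⟨
        cubic ⟨ F.0# , F.0# , c₂ F.- V4.c2 π′ , c₃ F.- V4.c3 π′ ⟩ s
                                                          ≡⟨ cong (λ z → cubic z s) (⟨⟩-cong (F.-‿inverseʳ c₀)
                                                               (F.solve 2 (λ c₁ c₀σ → c₁ :- ((c₁ :+ c₀σ) :- c₀σ) := F.:0) refl c₁ (c₀ F.* trace)) refl refl) ⟨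
        cubic (π −₄ π′) s                                 ≡⟨ cubic-sub π π′ s ⟩
        cubic π s K.- cubic π′ s                          ≡⟨ cong₂ K._-_ πs≡0 (trans (cubic-pencilPlane c₀ β s) (cong (K._* (ι c₀ K.* s K.+ ι β)) minpoly-s)) ⟩
        K.0# K.- K.0# K.* (ι c₀ K.* s K.+ ι β)            ≡⟨ K.solve 1 (λ x → K.:0 K.:- K.:0 K.:* x K.:= K.:0) refl _ ⟩
        K.0#                                              ∎)
        where open ≡-Reasoning

    private
      b-0σ≡b : ∀ b → b F.- F.0# F.* trace ≡ b
      b-0σ≡b b = F.solve 2 (λ b σ → b :- :0 :* σ := b) refl b trace
        where open F using (_:*_; _:-_; _:=_; :0)

    pencilPlane·P∞ : ∀ a b → pencilPlane a b · P nothing ≡ a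
    pencilPlane·P∞ a b = F.solve 4 (λ a b σ n → a :* :1 :+ (b :- a :* σ) :* :0 :+ (a :* n :- b :* σ) :* :0 :+ (b :* n) :* :0 := a)
                     refl a b trace norm
      where open F using (_:+_; _:*_; _:-_; _:=_; :0; :1)

    P∈pencilPlane⇒linear≡0 : Imaginary s → ∀ a b v → P (just v) ∈π pencilPlane a b → ι a K.* ι v K.+ ι b ≡ K.0#
    P∈pencilPlane⇒linear≡0 s∉F a b v v∈π =
      K.*-cancelˡ-0 (minpoly-ι≢0 s∉F v) (trans (sym (cubic-pencilPlane a b (ι v))) (∈π⇒cubic≡0 (pencilPlane a b) v v∈π))

    pencilPlane-normalized : ∀ {a b} → Normalized (pencilPlane a b) → a ≡ F.1# ⊎ (a ≡ F.0# × b ≡ F.1#)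
    pencilPlane-normalized (inj₁ a≡1) = inj₁ a≡1
    pencilPlane-normalized (inj₂ (inj₁ (refl , c₁≡1))) = inj₂ (refl , trans (sym (b-0σ≡b _)) c₁≡1)
    pencilPlane-normalized {b = b} (inj₂ (inj₂ (inj₁ (refl , c₁≡0 , c₂≡1)))) = ⊥-elim (F.0≢1 (begin
      F.0#                              ≡⟨ F.solve 2 (λ σ n → :0 := :0 :* n :- :0 :* σ) refl trace norm ⟩
      F.0# F.* norm F.- F.0# F.* trace   ≡⟨ cong (λ z → F.0# F.* norm F.- z F.* trace) (trans (sym (b-0σ≡b b)) c₁≡0) ⟨
      F.0# F.* norm F.- b F.* trace      ≡⟨ c₂≡1 ⟩
      F.1#                              ∎))
      where
      open ≡-Reasoning
      open F using (_:*_; _:-_; _:=_; :0)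
    pencilPlane-normalized {b = b} (inj₂ (inj₂ (inj₂ (refl , c₁≡0 , _ , c₃≡1)))) = ⊥-elim (F.0≢1 (begin
      F.0#             ≡⟨ F.zeroˡ norm ⟨
      F.0# F.* norm    ≡⟨ cong (F._* norm) (trans (sym (b-0σ≡b b)) c₁≡0) ⟨
      b F.* norm       ≡⟨ c₃≡1 ⟩
      F.1#             ∎))
      where open ≡-Reasoning

    pencil : List Vec4
    pencil = pencilPlane F.0# F.1# ∷ map (pencilPlane F.1#) F.elements

    length-pencil : length pencil ≡ q ℕ.+ 1
    length-pencil = trans (cong suc (trans (length-map (pencilPlane F.1#) F.elements) F.length-elements)) (ℕ.+-comm 1 q)

    pencil-unique : Unique pencil
    pencil-unique = All.tabulate pencilPlane∞≢ AllPairs.∷ Unique.map⁺ pencilPlane-injective F.elements-unique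
      where
      pencilPlane-injective : ∀ {b b′} → pencilPlane F.1# b ≡ pencilPlane F.1# b′ → b ≡ b′
      pencilPlane-injective {b} {b′} e = trans (F.solve 2 (λ b σ → b := (b :- :1 :* σ) :+ :1 :* σ) refl b trace)
        (trans (cong (F._+ F.1# F.* trace) (cong V4.c1 e)) (F.solve 2 (λ b σ → (b :- :1 :* σ) :+ :1 :* σ := b) refl b′ trace))
        where open F using (_:+_; _:*_; _:-_; _:=_; :1)
      pencilPlane∞≢ : ∀ {π} → π ∈ map (pencilPlane F.1#) F.elements → pencilPlane F.0# F.1# ≢ π
      pencilPlane∞≢ π∈ with ∈-map⁻ (pencilPlane F.1#) π∈
      ... | _ , _ , refl = F.0≢1 ∘ cong V4.c0

    pencil-planes : ∀ {π} → π ∈ pencil → ∃[ a ] ∃[ b ] ((a ≡ F.1# ⊎ b ≡ F.1#) × π ≡ pencilPlane a b)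
    pencil-planes (here refl) = F.0# , F.1# , inj₂ refl , refl
    pencil-planes (there π∈) with ∈-map⁻ (pencilPlane F.1#) π∈
    ... | β , _ , refl = F.1# , β , inj₁ refl , refl

    pencil-normalized : ∀ {π} → π ∈ pencil → Normalized π
    pencil-normalized (here refl) = inj₂ (inj₁ (refl , b-0σ≡b F.1#))
    pencil-normalized (there π∈) with ∈-map⁻ (pencilPlane F.1#) π∈
    ... | _ , _ , refl = inj₁ refl

    pencil-cubic : ∀ {π} → π ∈ pencil → ∀ t → minpoly t ≡ K.0# → cubic π t ≡ K.0#
    pencil-cubic π∈ t minpoly-t≡0 with pencil-planes π∈
    ... | a , b , _ , refl = trans (cubic-pencilPlane a b t) (trans (cong (K._* (ι a K.* t K.+ ι b)) minpoly-t≡0) (K.zeroˡ _))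

    pencil-ContainsChord : ∀ {π} → π ∈ pencil → ContainsChord π s
    pencil-ContainsChord π∈ = cubic≡0⇒ContainsChord _ s (pencil-cubic π∈ s minpoly-s) (pencil-cubic π∈ (conj s) minpoly-conj)

    cubic≡0⇒∈pencil : Imaginary s → ∀ π → Normalized π → cubic π s ≡ K.0# → π ∈ pencil
    cubic≡0⇒∈pencil s∉F π π-normalized πs≡0 =
      subst (_∈ pencil) (sym π≡pencilPlane) (pencilPlane-∈ (pencilPlane-normalized (subst Normalized π≡pencilPlane π-normalized)))
      where
      π≡pencilPlane : π ≡ pencilPlane (V4.c0 π) (V4.c1 π F.+ V4.c0 π F.* trace)
      π≡pencilPlane = cubic≡0⇒pencilPlane s∉F π πs≡0
      pencilPlane-∈ : ∀ {a b} → a ≡ F.1# ⊎ (a ≡ F.0# × b ≡ F.1#) → pencilPlane a b ∈ pencil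
      pencilPlane-∈ {b = b} (inj₁ refl) = there (∈-map⁺ (pencilPlane F.1#) (F.∈-elements b))
      pencilPlane-∈ (inj₂ (refl , refl)) = here refl

    -- The linear factor a t + b of the cubic cannot vanish at an imaginary t.
    ∈pencil⇒minpoly≡0 : ∀ t → Imaginary t → ∀ {π} → π ∈ pencil → cubic π t ≡ K.0# → minpoly t ≡ K.0#
    ∈pencil⇒minpoly≡0 t t∉F π∈ πt≡0 with pencil-planes π∈
    ... | a , b , a≡1⊎b≡1 , refl = K.*-cancelʳ-0 linear≢0 (trans (sym (cubic-pencilPlane a b t)) πt≡0)
      where
      linear≢0 : ι a K.* t K.+ ι b ≢ K.0#
      linear≢0 at+b≡0 = not-both-zero a≡1⊎b≡1 (Imaginary⇒independent t∉F a b at+b≡0)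
        where
        not-both-zero : a ≡ F.1# ⊎ b ≡ F.1# → ¬ (a ≡ F.0# × b ≡ F.0#)
        not-both-zero (inj₁ a≡1) (a≡0 , _) = F.0≢1 (trans (sym a≡0) a≡1)
        not-both-zero (inj₂ b≡1) (_ , b≡0) = F.0≢1 (trans (sym b≡0) b≡1)

    pencil-meets-once : Imaginary s → ∀ {π} → π ∈ pencil → PlaneMeetsC π 1
    pencil-meets-once s∉F (here refl) = nothing ∷ [] , [] AllPairs.∷ AllPairs.[] , pencilPlane·P∞ F.0# F.1# ∷ [] , only , refl
      where
      only : ∀ t → P t ∈π pencilPlane F.0# F.1# → t ∈ nothing ∷ []
      only nothing _ = here refl
      only (just v) v∈π = ⊥-elim (K.1≢0 (begin
        K.1#                              ≡⟨ K.solve 1 (λ v → :1 := :0 :* v :+ :1) refl (ι v) ⟩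
        K.0# K.* ι v K.+ K.1#             ≡⟨ cong₂ (λ a b → a K.* ι v K.+ b) ι-0 ι-1 ⟨
        ι F.0# K.* ι v K.+ ι F.1#         ≡⟨ P∈pencilPlane⇒linear≡0 s∉F F.0# F.1# v v∈π ⟩
        K.0#                              ∎))
        where
        open ≡-Reasoning
        open K using (_:+_; _:*_; _:=_; :0; :1)
    pencil-meets-once s∉F (there π∈) with ∈-map⁻ (pencilPlane F.1#) π∈
    ... | β , _ , refl = just (F.- β) ∷ [] , [] AllPairs.∷ AllPairs.[] , root ∷ [] , only , refl
      where
      root : P (just (F.- β)) ∈π pencilPlane F.1# β
      root = cubic≡0⇒∈π (pencilPlane F.1# β) (F.- β) (begin
        cubic (pencilPlane F.1# β) (ι (F.- β))                            ≡⟨ cubic-pencilPlane F.1# β (ι (F.- β)) ⟩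
        minpoly (ι (F.- β)) K.* (ι F.1# K.* ι (F.- β) K.+ ι β)
          ≡⟨ cong (λ z → minpoly (ι (F.- β)) K.* (z K.+ ι β)) (trans (sym (ι-* F.1# (F.- β))) (cong ι (F.*-identityˡ _))) ⟩
        minpoly (ι (F.- β)) K.* (ι (F.- β) K.+ ι β)
          ≡⟨ cong (minpoly (ι (F.- β)) K.*_) (trans (sym (ι-+ (F.- β) β)) (trans (cong ι (F.-‿inverseˡ β)) ι-0)) ⟩
        minpoly (ι (F.- β)) K.* K.0#                                 ≡⟨ K.zeroʳ _ ⟩
        K.0#                                                         ∎)
        where open ≡-Reasoning
      only : ∀ t → P t ∈π pencilPlane F.1# β → t ∈ just (F.- β) ∷ []
      only nothing ∞∈π = ⊥-elim (F.1≢0 (trans (sym (pencilPlane·P∞ F.1# β)) ∞∈π))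
      only (just v) v∈π = here (cong just (F.x+y≡0⇒x≡-y (ι-injective (begin
        ι (v F.+ β)                        ≡⟨ ι-+ v β ⟩
        ι v K.+ ι β                        ≡⟨ cong (K._+ ι β) (trans (sym (K.*-identityˡ (ι v))) (cong (K._* ι v) (sym ι-1))) ⟩
        ι F.1# K.* ι v K.+ ι β             ≡⟨ P∈pencilPlane⇒linear≡0 s∉F F.1# β v v∈π ⟩
        K.0#                               ≡⟨ ι-0 ⟨
        ι F.0#                             ∎))))
        where open ≡-Reasoning

    pencil-Bar1 : Imaginary s → ∀ {π} → π ∈ pencil → Bar1Plane π
    pencil-Bar1 s∉F π∈ = cubic≡0⇒¬ΓPlane _ s s∉F (pencil-cubic π∈ s minpoly-s) , pencil-meets-once s∉F π∈

n+n≡m+m⇒n≡m : ∀ {n m} → n ℕ.+ n ≡ m ℕ.+ m → n ≡ m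
n+n≡m+m⇒n≡m {n} {m} n+n≡m+m = ℕ.*-cancelˡ-≡ n m 2 (begin
  2 ℕ.* n          ≡⟨ cong (n ℕ.+_) (ℕ.+-identityʳ n) ⟩
  n ℕ.+ n          ≡⟨ n+n≡m+m ⟩
  m ℕ.+ m          ≡⟨ cong (m ℕ.+_) (ℕ.+-identityʳ m) ⟨
  2 ℕ.* m          ∎)
  where open ≡-Reasoning

nC2+nC2+n≡n*n : ∀ n → n C 2 ℕ.+ n C 2 ℕ.+ n ≡ n ℕ.* n
nC2+nC2+n≡n*n zero = refl
nC2+nC2+n≡n*n (suc n) = begin
  suc n C 2 ℕ.+ suc n C 2 ℕ.+ suc n              ≡⟨ cong (λ x → x ℕ.+ x ℕ.+ suc n) [1+n]C2≡n+nC2 ⟨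
  (n ℕ.+ n C 2) ℕ.+ (n ℕ.+ n C 2) ℕ.+ suc n       ≡⟨ solve 2 (λ n c → (n :+ c) :+ (n :+ c) :+ (con 1 :+ n) := (c :+ c :+ n) :+ (con 1 :+ n :+ n)) refl n (n C 2) ⟩
  (n C 2 ℕ.+ n C 2 ℕ.+ n) ℕ.+ (suc n ℕ.+ n)       ≡⟨ cong (ℕ._+ (suc n ℕ.+ n)) (nC2+nC2+n≡n*n n) ⟩
  n ℕ.* n ℕ.+ (suc n ℕ.+ n)                       ≡⟨ solve 1 (λ n → n :* n :+ (con 1 :+ n :+ n) := (con 1 :+ n) :* (con 1 :+ n)) refl n ⟩
  suc n ℕ.* suc n                                 ∎
  where
  open ≡-Reasoning
  open +-*-Solver
  [1+n]C2≡n+nC2 : n ℕ.+ n C 2 ≡ suc n C 2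
  [1+n]C2≡n+nC2 = trans (cong (ℕ._+ n C 2) (sym (nC1≡n n))) (nCk+nC[k+1]≡[n+1]C[k+1] n 1)

module ImaginaryChords {q : ℕ} (p k : ℕ) (p-prime : Prime p) (q≡p^k : q ≡ p ℕ.^ k) (2≤q : 2 ≤ q)
                       (F : FiniteField q) (K : FiniteField (q ℕ.* q)) (E : Embedding F K) where

  open Pencils p k p-prime q≡p^k 2≤q F K E public

  imaginaries : List K.Carrier
  imaginaries = filter (¬? ∘ InF?) K.elements

  imaginaries-unique : Unique imaginaries
  imaginaries-unique = Unique.filter⁺ (¬? ∘ InF?) K.elements-unique

  ∈-imaginaries : ∀ {s} → Imaginary s → s ∈ imaginaries
  ∈-imaginaries {s} s∉F = ∈-filter⁺ (¬? ∘ InF?) (K.∈-elements s) s∉F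

  imaginaries-Imaginary : ∀ {s} → s ∈ imaginaries → Imaginary s
  imaginaries-Imaginary s∈ = proj₂ (∈-filter⁻ (¬? ∘ InF?) {xs = K.elements} s∈)

  length-imaginaries : length imaginaries ℕ.+ q ≡ q ℕ.* q
  length-imaginaries = begin
    length imaginaries ℕ.+ q                           ≡⟨ ℕ.+-comm _ q ⟩
    q ℕ.+ length imaginaries                           ≡⟨ cong (ℕ._+ length imaginaries) |F|≡q ⟨
    length (map ι F.elements) ℕ.+ length imaginaries   ≡⟨ length-++ (map ι F.elements) ⟨
    length (map ι F.elements ++ imaginaries)
      ≡⟨ ↭-length (↭-of-⊆⊇ F++imaginaries-unique K.elements-unique (λ {x} _ → K.∈-elements x) everything) ⟩
    length K.elements                                  ≡⟨ K.length-elements ⟩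
    q ℕ.* q                                            ∎
    where
    open ≡-Reasoning
    |F|≡q : length (map ι F.elements) ≡ q
    |F|≡q = trans (length-map ι F.elements) F.length-elements
    F++imaginaries-unique : Unique (map ι F.elements ++ imaginaries)
    F++imaginaries-unique = Unique.++⁺ (Unique.map⁺ ι-injective F.elements-unique) imaginaries-unique
      λ (ιa∈ , s∈) → let a , _ , s≡ιa = ∈-map⁻ ι ιa∈ in imaginaries-Imaginary s∈ (a , sym s≡ιa)
    everything : ∀ {x} → x ∈ K.elements → x ∈ map ι F.elements ++ imaginaries
    everything {x} _ with InF? x
    ... | yes (a , refl) = ∈-++⁺ˡ (∈-map⁺ ι (F.∈-elements a))
    ... | no x∉F = ∈-++⁺ʳ (map ι F.elements) (∈-imaginaries x∉F)

  open K.ConjugatePairs conj conj-involutive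

  -- One s from each conjugate pair {s, s^q}, that is, one for each imaginary chord.
  chords : List K.Carrier
  chords = representatives (length imaginaries) imaginaries

  module chords = Representatives
    (representatives-correct (length imaginaries) imaginaries imaginaries-unique
      (λ s∈ → ∈-imaginaries (Imaginary-conj (imaginaries-Imaginary s∈)) , Imaginary⇒conj≢ (imaginaries-Imaginary s∈))
      ℕ.≤-refl)

  chords-Imaginary : ∀ {s} → s ∈ chords → Imaginary s
  chords-Imaginary = imaginaries-Imaginary ∘ chords.⊆-all

  length-chords+length-chords+q≡q*q : length chords ℕ.+ length chords ℕ.+ q ≡ q ℕ.* q
  length-chords+length-chords+q≡q*q = trans (cong (ℕ._+ q) chords.twice-length) length-imaginaries

  length-chords : length chords ≡ q C 2
  length-chords = n+n≡m+m⇒n≡m (ℕ.+-cancelʳ-≡ q _ _ (trans length-chords+length-chords+q≡q*q (sym (nC2+nC2+n≡n*n q))))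

  -- (b , c) stands for the monic quadratic X² + bX + c over F_q.
  Quadratic : Set
  Quadratic = F.Carrier × F.Carrier

  evalQ : Quadratic → F.Carrier → F.Carrier
  evalQ (b , c) w = w F.* w F.+ b F.* w F.+ c

  Irreducible : Quadratic → Set
  Irreducible z = ∀ w → evalQ z w ≢ F.0#

  withRoots : F.Carrier × F.Carrier → Quadratic
  withRoots (u , v) = F.- (u F.+ v) , u F.* v

  evalQ-withRoots : ∀ u v w → evalQ (withRoots (u , v)) w ≡ (w F.- u) F.* (w F.- v)
  evalQ-withRoots u v w = F.solve 3 (λ u v w → w :* w :+ :- (u :+ v) :* w :+ u :* v := (w :- u) :* (w :- v)) refl u v w
    where open F using (_:+_; _:*_; _:-_; :-_; _:=_)

  withRoots-reducible : ∀ u v → ¬ Irreducible (withRoots (u , v))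
  withRoots-reducible u v irreducible =
    irreducible u (trans (evalQ-withRoots u v u) (trans (cong (F._* (u F.- v)) (F.-‿inverseʳ u)) (F.zeroˡ _)))

  withRoots-root : ∀ {a b u v} → withRoots (a , b) ≡ withRoots (u , v) → a ≡ u ⊎ a ≡ v
  withRoots-root {a} {b} {u} {v} e with F.noZeroDivisors (begin
      (a F.- u) F.* (a F.- v)         ≡⟨ evalQ-withRoots u v a ⟨
      evalQ (withRoots (u , v)) a     ≡⟨ cong (λ z → evalQ z a) e ⟨
      evalQ (withRoots (a , b)) a     ≡⟨ evalQ-withRoots a b a ⟩
      (a F.- a) F.* (a F.- b)         ≡⟨ cong (F._* (a F.- b)) (F.-‿inverseʳ a) ⟩
      F.0# F.* (a F.- b)              ≡⟨ F.zeroˡ _ ⟩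
      F.0#                            ∎)
    where open ≡-Reasoning
  ... | inj₁ a-u≡0 = inj₁ (F.x-y≡0⇒x≡y a-u≡0)
  ... | inj₂ a-v≡0 = inj₂ (F.x-y≡0⇒x≡y a-v≡0)

  reducibles : List Quadratic
  reducibles = map withRoots (unorderedPairs F.elements)

  private
    withRoots-pairs-unique : ∀ xs → Unique xs → Unique (map withRoots (unorderedPairs xs))
    withRoots-pairs-unique [] _ = AllPairs.[]
    withRoots-pairs-unique (a ∷ as) (a∉as AllPairs.∷ uas) =
      subst Unique (sym (map-++ withRoots (map (a ,_) (a ∷ as)) (unorderedPairs as)))
        (Unique.++⁺ row-unique (withRoots-pairs-unique as uas) row#rest)
      where
      row-injective : ∀ {b b′} → withRoots (a , b) ≡ withRoots (a , b′) → b ≡ b′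
      row-injective {b} {b′} e = trans (F.solve 2 (λ a b → b := (a :+ b) :- a) refl a b)
        (trans (cong (F._- a) (F.⁻¹-injective (cong proj₁ e))) (F.solve 2 (λ a b → (a :+ b) :- a := b) refl a b′))
        where open F using (_:+_; _:-_; _:=_)
      row-unique : Unique (map withRoots (map (a ,_) (a ∷ as)))
      row-unique = subst Unique (map-∘ (a ∷ as)) (Unique.map⁺ row-injective (a∉as AllPairs.∷ uas))
      row#rest : ∀ {z} → z ∈ map withRoots (map (a ,_) (a ∷ as)) × z ∈ map withRoots (unorderedPairs as) → ⊥
      row#rest (z∈row , z∈rest) with ∈-map⁻ withRoots z∈row | ∈-map⁻ withRoots z∈rest
      ... | _ , ab∈ , refl | (u , v) , uv∈ , e with ∈-map⁻ (a ,_) ab∈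
      ...   | b , _ , refl with withRoots-root e
      ...     | inj₁ refl = All.lookup a∉as (proj₁ (∈-unorderedPairs⁻ as uv∈)) refl
      ...     | inj₂ refl = All.lookup a∉as (proj₂ (∈-unorderedPairs⁻ as uv∈)) refl

  reducibles-unique : Unique reducibles
  reducibles-unique = withRoots-pairs-unique F.elements F.elements-unique

  reducibles-reducible : ∀ {z} → z ∈ reducibles → ¬ Irreducible z
  reducibles-reducible z∈ with ∈-map⁻ withRoots z∈
  ... | (u , v) , _ , refl = withRoots-reducible u v

  length-reducibles : length reducibles ℕ.+ length reducibles ≡ q ℕ.* suc q
  length-reducibles = trans (cong (λ n → n ℕ.+ n) (length-map withRoots (unorderedPairs F.elements)))
    (trans (length-unorderedPairs F.elements) (cong (λ n → n ℕ.* suc n) F.length-elements))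

  chordQuadratic : K.Carrier → Quadratic
  chordQuadratic s = F.- Chord.trace s , Chord.norm s

  ι-evalQ : ∀ s v → ι (evalQ (chordQuadratic s) v) ≡ Chord.minpoly s (ι v)
  ι-evalQ s v = begin
    ι (v F.* v F.+ F.- σ F.* v F.+ n)                    ≡⟨ trans (ι-+ _ _) (cong (K._+ ι n) (ι-+ _ _)) ⟩
    ι (v F.* v) K.+ ι (F.- σ F.* v) K.+ ι n              ≡⟨ cong₂ (λ a b → a K.+ b K.+ ι n) (ι-* v v) (trans (ι-* _ v) (cong (K._* ι v) (ι-neg σ))) ⟩
    ι v K.* ι v K.+ K.- ι σ K.* ι v K.+ ι n              ≡⟨ K.solve 3 (λ v σ n → v :* v :+ :- σ :* v :+ n := v :* v :- σ :* v :+ n) refl (ι v) (ι σ) (ι n) ⟩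
    ι v K.* ι v K.- ι σ K.* ι v K.+ ι n                  ∎
    where
    open ≡-Reasoning
    open K using (_:+_; _:*_; _:-_; :-_; _:=_)
    σ = Chord.trace s
    n = Chord.norm s

  chordQuadratic-root : ∀ s → s K.* s K.+ ι (proj₁ (chordQuadratic s)) K.* s K.+ ι (proj₂ (chordQuadratic s)) ≡ K.0#
  chordQuadratic-root s = trans (cong (λ x → s K.* s K.+ x K.* s K.+ ι (Chord.norm s)) (ι-neg _))
    (trans (K.solve 3 (λ s σ n → s :* s :+ :- σ :* s :+ n := s :* s :- σ :* s :+ n) refl s (ι (Chord.trace s)) (ι (Chord.norm s)))
      (Chord.minpoly-s s))
    where open K using (_:+_; _:*_; _:-_; :-_; _:=_)

  chordQuadratic-Irreducible : ∀ {s} → Imaginary s → Irreducible (chordQuadratic s)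
  chordQuadratic-Irreducible {s} s∉F v v-root =
    Chord.minpoly-ι≢0 s s∉F v (trans (sym (ι-evalQ s v)) (trans (cong ι v-root) ι-0))

  chordQuadratic≡⇒minpoly≡0 : ∀ {s t} → chordQuadratic s ≡ chordQuadratic t → Chord.minpoly t s ≡ K.0#
  chordQuadratic≡⇒minpoly≡0 {s} {t} e = trans
    (cong₂ (λ σ n → s K.* s K.- ι σ K.* s K.+ ι n) (sym (F.⁻¹-injective (cong proj₁ e))) (sym (cong proj₂ e)))
    (Chord.minpoly-s s)

  chordQuadratics : List Quadratic
  chordQuadratics = map chordQuadratic chords

  chords-separated : AllPairs (λ s t → Chord.minpoly t s ≢ K.0#) chords
  chords-separated = AllPairs.map separated chords.pairwise-distinct
    where
    separated : ∀ {s t} → s ≢ t × s ≢ conj t → Chord.minpoly t s ≢ K.0#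
    separated (s≢t , s≢t̄) minpoly-t-s≡0 with Chord.minpoly-roots _ _ minpoly-t-s≡0
    ... | inj₁ s≡t = s≢t s≡t
    ... | inj₂ s≡t̄ = s≢t̄ s≡t̄

  chordQuadratics-unique : Unique chordQuadratics
  chordQuadratics-unique = AllPairs.map⁺ (AllPairs.map (λ separated e → separated (chordQuadratic≡⇒minpoly≡0 e)) chords-separated)

  quadratics-HasSize : HasSize Quadratic (λ _ → ⊤) (q ℕ.* q)
  quadratics-HasSize = cartesianProduct F.elements F.elements
    , Unique.cartesianProduct⁺ F.elements-unique F.elements-unique
    , All.tabulate (λ _ → tt)
    , (λ (b , c) _ → ∈-cartesianProduct⁺ (F.∈-elements b) (F.∈-elements c))
    , trans (length-cartesianProduct F.elements F.elements) (cong₂ ℕ._*_ F.length-elements F.length-elements)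

  length-reducibles++chordQuadratics : length (reducibles ++ chordQuadratics) ≡ q ℕ.* q
  length-reducibles++chordQuadratics = n+n≡m+m⇒n≡m (begin
    |all| ℕ.+ |all|
      ≡⟨ cong (λ n → n ℕ.+ n) (trans (length-++ reducibles) (cong (r ℕ.+_) (length-map chordQuadratic chords))) ⟩
    (r ℕ.+ c) ℕ.+ (r ℕ.+ c)                           ≡⟨ solve 2 (λ r c → (r :+ c) :+ (r :+ c) := (r :+ r) :+ (c :+ c)) refl r c ⟩
    (r ℕ.+ r) ℕ.+ (c ℕ.+ c)                           ≡⟨ cong (ℕ._+ (c ℕ.+ c)) length-reducibles ⟩
    q ℕ.* suc q ℕ.+ (c ℕ.+ c)                         ≡⟨ solve 2 (λ q c → q :* (con 1 :+ q) :+ (c :+ c) := q :* q :+ (c :+ c :+ q)) refl q c ⟩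
    q ℕ.* q ℕ.+ (c ℕ.+ c ℕ.+ q)                       ≡⟨ cong (q ℕ.* q ℕ.+_) length-chords+length-chords+q≡q*q ⟩
    q ℕ.* q ℕ.+ q ℕ.* q                               ∎)
    where
    open ≡-Reasoning
    open +-*-Solver
    |all| = length (reducibles ++ chordQuadratics)
    r = length reducibles
    c = length chords

  reducibles++chordQuadratics-unique : Unique (reducibles ++ chordQuadratics)
  reducibles++chordQuadratics-unique = Unique.++⁺ reducibles-unique chordQuadratics-unique λ (z∈red , z∈chord) →
    let s , s∈ , z≡ = ∈-map⁻ chordQuadratic z∈chord in
    reducibles-reducible z∈red (subst Irreducible (sym z≡) (chordQuadratic-Irreducible (chords-Imaginary s∈)))

  -- There are q(q+1)/2 reducible and C(q,2) chord quadratics, q² in total: every quadratic is one of them.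
  irreducible⇒chordQuadratic : ∀ z → Irreducible z → ∃[ s ] (s ∈ chords × z ≡ chordQuadratic s)
  irreducible⇒chordQuadratic z irreducible = [ (λ z∈red → ⊥-elim (reducibles-reducible z∈red irreducible))
                                               , ∈-map⁻ chordQuadratic ]′ (∈-++⁻ reducibles z∈all)
    where
    open DistinctLists (Product.≡-dec F._≟_ F._≟_) using (HasSize-complete)
    z∈all : z ∈ reducibles ++ chordQuadratics
    z∈all = HasSize-complete quadratics-HasSize (reducibles ++ chordQuadratics)
              reducibles++chordQuadratics-unique (All.tabulate (λ _ → tt)) length-reducibles++chordQuadratics z tt

  HasImaginaryRoot : Vec4 → Set
  HasImaginaryRoot π = ∃[ s ] (Imaginary s × cubic π s ≡ K.0#)

  irreducible⇒imaginaryRoot : ∀ b c → Irreducible (b , c) → ∃[ s ] (Imaginary s × s K.* s K.+ ι b K.* s K.+ ι c ≡ K.0#)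
  irreducible⇒imaginaryRoot b c irreducible =
    let s , s∈ , bc≡ = irreducible⇒chordQuadratic (b , c) irreducible in
    s , chords-Imaginary s∈ , subst (λ z → s K.* s K.+ ι (proj₁ z) K.* s K.+ ι (proj₂ z) ≡ K.0#) (sym bc≡) (chordQuadratic-root s)

  private
    P∞∈⟨0,c₁,c₂,c₃⟩ : ∀ c₁ c₂ c₃ → P nothing ∈π ⟨ F.0# , c₁ , c₂ , c₃ ⟩
    P∞∈⟨0,c₁,c₂,c₃⟩ c₁ c₂ c₃ = F.solve 3 (λ c₁ c₂ c₃ → :0 :* :1 :+ c₁ :* :0 :+ c₂ :* :0 :+ c₃ :* :0 := :0) refl c₁ c₂ c₃
      where open F using (_:+_; _:*_; _:=_; :0; :1)

    ¬Bar1-⟨0,0,1,c₃⟩ : ∀ c₃ → ¬ Bar1Plane ⟨ F.0# , F.0# , F.1# , c₃ ⟩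
    ¬Bar1-⟨0,0,1,c₃⟩ c₃ (_ , (x₀ ∷ [] , _ , _ , only , refl)) =
      nothing≢just (trans (∈-[x]⁻ (only nothing (P∞∈⟨0,c₁,c₂,c₃⟩ F.0# F.1# c₃))) (sym (∈-[x]⁻ (only (just (F.- c₃)) P[-c₃]∈π))))
      where
      open F using (_:+_; _:*_; :-_; _:=_; :0; :1)
      P[-c₃]∈π : P (just (F.- c₃)) ∈π ⟨ F.0# , F.0# , F.1# , c₃ ⟩
      P[-c₃]∈π = F.solve 1 (λ c₃ → :0 :* (:- c₃ :* (:- c₃ :* (:- c₃ :* :1))) :+ :0 :* (:- c₃ :* (:- c₃ :* :1)) :+ :1 :* :- c₃ :+ c₃ :* :1 := :0) refl c₃
      nothing≢just : ∀ {v} → nothing ≢ just v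
      nothing≢just ()

    ¬Bar1-⟨0,0,0,1⟩ : ¬ Bar1Plane ⟨ F.0# , F.0# , F.0# , F.1# ⟩
    ¬Bar1-⟨0,0,0,1⟩ (¬Γ , _) =
      ¬Γ (nothing , F.1# , F.1≢0 , ⟨⟩-cong (sym (F.zeroʳ F.1#)) (sym (F.zeroʳ F.1#)) (sym (F.zeroʳ F.1#)) (sym (F.*-identityˡ F.1#)))

    -- P(∞) is the only point of C on the plane, so t² + c₂t + c₃ has no root in F_q.
    Bar1⇒imaginaryRoot-⟨0,1,c₂,c₃⟩ : ∀ c₂ c₃ → Bar1Plane ⟨ F.0# , F.1# , c₂ , c₃ ⟩ → HasImaginaryRoot ⟨ F.0# , F.1# , c₂ , c₃ ⟩
    Bar1⇒imaginaryRoot-⟨0,1,c₂,c₃⟩ c₂ c₃ (_ , (x₀ ∷ [] , _ , _ , only , refl)) = s , s∉F , (begin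
      ι F.0# K.* K.pow s 3 K.+ ι F.1# K.* K.pow s 2 K.+ ι c₂ K.* s K.+ ι c₃ K.* K.1#
        ≡⟨ cong₂ (λ a b → a K.* K.pow s 3 K.+ b K.* K.pow s 2 K.+ ι c₂ K.* s K.+ ι c₃ K.* K.1#) ι-0 ι-1 ⟩
      K.0# K.* K.pow s 3 K.+ K.1# K.* K.pow s 2 K.+ ι c₂ K.* s K.+ ι c₃ K.* K.1#
        ≡⟨ K.solve 3 (λ s c₂ c₃ → :0 :* (s :* (s :* (s :* :1))) :+ :1 :* (s :* (s :* :1)) :+ c₂ :* s :+ c₃ :* :1 := s :* s :+ c₂ :* s :+ c₃) refl s (ι c₂) (ι c₃) ⟩
      s K.* s K.+ ι c₂ K.* s K.+ ι c₃
        ≡⟨ s-root ⟩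
      K.0# ∎)
      where
      open ≡-Reasoning
      open K using (_:+_; _:*_; _:=_; :0; :1)
      ∞≡x₀ : nothing ≡ x₀
      ∞≡x₀ = ∈-[x]⁻ (only nothing (P∞∈⟨0,c₁,c₂,c₃⟩ F.1# c₂ c₃))
      irreducible : Irreducible (c₂ , c₃)
      irreducible v v-root = just≢nothing (trans (∈-[x]⁻ (only (just v) (trans (F.solve 3 (λ v c₂ c₃ →
          F.:0 F.:* (v F.:* (v F.:* (v F.:* F.:1))) F.:+ F.:1 F.:* (v F.:* (v F.:* F.:1)) F.:+ c₂ F.:* v F.:+ c₃ F.:* F.:1
            F.:= v F.:* v F.:+ c₂ F.:* v F.:+ c₃) refl v c₂ c₃) v-root))) (sym ∞≡x₀))
        where
        just≢nothing : ∀ {v} → just v ≢ nothing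
        just≢nothing ()
      root = irreducible⇒imaginaryRoot c₂ c₃ irreducible
      s = proj₁ root
      s∉F : Imaginary s
      s∉F = proj₁ (proj₂ root)
      s-root : s K.* s K.+ ι c₂ K.* s K.+ ι c₃ ≡ K.0#
      s-root = proj₂ (proj₂ root)

    -- Split off the unique point P(u): the cubic is (t - u)(t² + bt + c).  An F_q-root of the quadratic
    -- would have to be u twice over, which makes π the osculating plane at P(u).
    Bar1⇒imaginaryRoot-⟨1,c₁,c₂,c₃⟩ : ∀ c₁ c₂ c₃ → Bar1Plane ⟨ F.1# , c₁ , c₂ , c₃ ⟩ → HasImaginaryRoot ⟨ F.1# , c₁ , c₂ , c₃ ⟩
    Bar1⇒imaginaryRoot-⟨1,c₁,c₂,c₃⟩ c₁ c₂ c₃ (_ , (nothing ∷ [] , _ , ∞∈π ∷ [] , _ , refl)) =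
      ⊥-elim (F.1≢0 (trans (sym (F.solve 3 (λ c₁ c₂ c₃ → :1 :* :1 :+ c₁ :* :0 :+ c₂ :* :0 :+ c₃ :* :0 := :1) refl c₁ c₂ c₃)) ∞∈π))
      where open F using (_:+_; _:*_; _:=_; :0; :1)
    Bar1⇒imaginaryRoot-⟨1,c₁,c₂,c₃⟩ c₁ c₂ c₃ (¬Γ , (just u ∷ [] , _ , u∈π ∷ [] , only , refl)) =
      decide (any? (λ w → evalQ (b , c) w F.≟ F.0#) F.elements)
      where
      π = ⟨ F.1# , c₁ , c₂ , c₃ ⟩
      b = c₁ F.+ u
      c = c₂ F.+ u F.* b
      f : F.Carrier → F.Carrier
      f v = π · P (just v)
      f-factors : ∀ v → f v ≡ (v F.- u) F.* evalQ (b , c) v F.+ f u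
      f-factors v = F.solve 5 (λ v u c₁ c₂ c₃ →
          :1 :* (v :* (v :* (v :* :1))) :+ c₁ :* (v :* (v :* :1)) :+ c₂ :* v :+ c₃ :* :1
          := (v :- u) :* (v :* v :+ (c₁ :+ u) :* v :+ (c₂ :+ u :* (c₁ :+ u)))
             :+ (:1 :* (u :* (u :* (u :* :1))) :+ c₁ :* (u :* (u :* :1)) :+ c₂ :* u :+ c₃ :* :1)) refl v u c₁ c₂ c₃
        where open F using (_:+_; _:*_; _:-_; _:=_; :1)
      quadratic-root⇒≡u : ∀ v → evalQ (b , c) v ≡ F.0# → v ≡ u
      quadratic-root⇒≡u v v-root = just-injective (∈-[x]⁻ (only (just v) (begin
        f v                                         ≡⟨ f-factors v ⟩
        (v F.- u) F.* evalQ (b , c) v F.+ f u       ≡⟨ cong₂ (λ x y → (v F.- u) F.* x F.+ y) v-root u∈π ⟩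
        (v F.- u) F.* F.0# F.+ F.0#                 ≡⟨ F.solve 2 (λ v u → (v F.:- u) F.:* F.:0 F.:+ F.:0 F.:= F.:0) refl v u ⟩
        F.0#                                        ∎)))
        where
        open ≡-Reasoning
      decide : Dec (Any (λ w → evalQ (b , c) w ≡ F.0#) F.elements) → HasImaginaryRoot π
      decide (yes found) = ⊥-elim (¬Γ (just u , F.1# , F.1≢0 , ⟨⟩-cong (sym (F.*-identityˡ F.1#))
          (trans c₁≡ (sym (F.*-identityˡ _))) (trans c₂≡ (sym (F.*-identityˡ _))) (trans c₃≡ (sym (F.*-identityˡ _)))))
        where
        open ≡-Reasoning
        open F using (_:+_; _:*_; _:-_; :-_; _:=_; :0; :1)
        w = proj₁ (Any.satisfied found)
        u-root : evalQ (b , c) u ≡ F.0#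
        u-root = subst (λ x → evalQ (b , c) x ≡ F.0#) (quadratic-root⇒≡u w (proj₂ (Any.satisfied found))) (proj₂ (Any.satisfied found))
        -- the other root of the quadratic
        -b-u≡u : F.- b F.- u ≡ u
        -b-u≡u = quadratic-root⇒≡u (F.- b F.- u)
          (trans (F.solve 3 (λ b c u → (:- b :- u) :* (:- b :- u) :+ b :* (:- b :- u) :+ c := u :* u :+ b :* u :+ c) refl b c u) u-root)
        c₁≡ : c₁ ≡ F.- (F.3# F.* u)
        c₁≡ = begin
          c₁                                ≡⟨ F.solve 2 (λ c₁ u → c₁ := :- ((:- (c₁ :+ u) :- u) :+ u :+ u)) refl c₁ u ⟩
          F.- ((F.- b F.- u) F.+ u F.+ u)   ≡⟨ cong (λ x → F.- (x F.+ u F.+ u)) -b-u≡u ⟩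
          F.- (u F.+ u F.+ u)               ≡⟨ F.solve 1 (λ u → :- (u :+ u :+ u) := :- ((:1 :+ :1 :+ :1) :* u)) refl u ⟩
          F.- (F.3# F.* u)                  ∎
        c₂≡ : c₂ ≡ F.3# F.* F.pow u 2
        c₂≡ = begin
          c₂                                                          ≡⟨ F.solve 3 (λ u c₁ c₂ → c₂ :=
             (u :* u :+ (c₁ :+ u) :* u :+ (c₂ :+ u :* (c₁ :+ u))) :- u :* u :- (c₁ :+ u) :* u :- u :* (c₁ :+ u)) refl u c₁ c₂ ⟩
          evalQ (b , c) u F.- u F.* u F.- b F.* u F.- u F.* b          ≡⟨ cong₂ (λ x y → x F.- u F.* u F.- (y F.+ u) F.* u F.- u F.* (y F.+ u)) u-root c₁≡ ⟩
          F.0# F.- u F.* u F.- (F.- (F.3# F.* u) F.+ u) F.* u F.- u F.* (F.- (F.3# F.* u) F.+ u)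
                                                                      ≡⟨ F.solve 1 (λ u → :0 :- u :* u :- (:- ((:1 :+ :1 :+ :1) :* u) :+ u) :* u :- u :* (:- ((:1 :+ :1 :+ :1) :* u) :+ u)
                                                                           := (:1 :+ :1 :+ :1) :* (u :* (u :* :1))) refl u ⟩
          F.3# F.* F.pow u 2                                          ∎
        c₃≡ : c₃ ≡ F.- F.pow u 3
        c₃≡ = begin
          c₃                                                          ≡⟨ F.solve 4 (λ u c₁ c₂ c₃ → c₃ :=
             (:1 :* (u :* (u :* (u :* :1))) :+ c₁ :* (u :* (u :* :1)) :+ c₂ :* u :+ c₃ :* :1) :- (u :* (u :* (u :* :1)) :+ c₁ :* (u :* (u :* :1)) :+ c₂ :* u))
             refl u c₁ c₂ c₃ ⟩
          f u F.- (F.pow u 3 F.+ c₁ F.* F.pow u 2 F.+ c₂ F.* u)        ≡⟨ cong₂ (λ x y → x F.- (F.pow u 3 F.+ y F.* F.pow u 2 F.+ c₂ F.* u)) u∈π c₁≡ ⟩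
          F.0# F.- (F.pow u 3 F.+ F.- (F.3# F.* u) F.* F.pow u 2 F.+ c₂ F.* u)
                                                                      ≡⟨ cong (λ y → F.0# F.- (F.pow u 3 F.+ F.- (F.3# F.* u) F.* F.pow u 2 F.+ y F.* u)) c₂≡ ⟩
          F.0# F.- (F.pow u 3 F.+ F.- (F.3# F.* u) F.* F.pow u 2 F.+ (F.3# F.* F.pow u 2) F.* u)
                                                                      ≡⟨ F.solve 1 (λ u → :0 :- (u :* (u :* (u :* :1)) :+ :- ((:1 :+ :1 :+ :1) :* u) :* (u :* (u :* :1))
                                                                             :+ ((:1 :+ :1 :+ :1) :* (u :* (u :* :1))) :* u) := :- (u :* (u :* (u :* :1)))) refl u ⟩
          F.- F.pow u 3                                               ∎
      decide (no none) = s , s∉F , (begin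
        cubic π s                                                    ≡⟨ cubic-factors s ⟩
        (s K.- ι u) K.* (s K.* s K.+ ι b K.* s K.+ ι c) K.+ cubic π (ι u)
                                                                     ≡⟨ cong₂ (λ x y → (s K.- ι u) K.* x K.+ y) s-root (∈π⇒cubic≡0 π u u∈π) ⟩
        (s K.- ι u) K.* K.0# K.+ K.0#                                ≡⟨ K.solve 2 (λ s u → (s :- u) :* :0 :+ :0 := :0) refl s (ι u) ⟩
        K.0#                                                         ∎)
        where
        open ≡-Reasoning
        open K using (_:+_; _:*_; _:-_; _:=_; :0; :1)
        cubic-factors : ∀ t → cubic π t ≡ (t K.- ι u) K.* (t K.* t K.+ ι b K.* t K.+ ι c) K.+ cubic π (ι u)
        cubic-factors t = begin
          ι F.1# K.* K.pow t 3 K.+ C₁ K.* K.pow t 2 K.+ C₂ K.* t K.+ C₃ K.* K.1#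
            ≡⟨ cong (λ a → a K.* K.pow t 3 K.+ C₁ K.* K.pow t 2 K.+ C₂ K.* t K.+ C₃ K.* K.1#) ι-1 ⟩
          K.1# K.* K.pow t 3 K.+ C₁ K.* K.pow t 2 K.+ C₂ K.* t K.+ C₃ K.* K.1#
            ≡⟨ K.solve 5 (λ t U C₁ C₂ C₃ →
                 :1 :* (t :* (t :* (t :* :1))) :+ C₁ :* (t :* (t :* :1)) :+ C₂ :* t :+ C₃ :* :1
                 := (t :- U) :* (t :* t :+ (C₁ :+ U) :* t :+ (C₂ :+ U :* (C₁ :+ U)))
                    :+ (:1 :* (U :* (U :* (U :* :1))) :+ C₁ :* (U :* (U :* :1)) :+ C₂ :* U :+ C₃ :* :1)) refl t (ι u) C₁ C₂ C₃ ⟩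
          (t K.- ι u) K.* (t K.* t K.+ (C₁ K.+ ι u) K.* t K.+ (C₂ K.+ ι u K.* (C₁ K.+ ι u))) K.+ (K.1# K.* K.pow (ι u) 3 K.+ C₁ K.* K.pow (ι u) 2 K.+ C₂ K.* ι u K.+ C₃ K.* K.1#)
            ≡⟨ cong₂ (λ x y → (t K.- ι u) K.* (t K.* t K.+ x K.* t K.+ y) K.+ (K.1# K.* K.pow (ι u) 3 K.+ C₁ K.* K.pow (ι u) 2 K.+ C₂ K.* ι u K.+ C₃ K.* K.1#)) ιb ιc ⟨
          (t K.- ι u) K.* (t K.* t K.+ ι b K.* t K.+ ι c) K.+ (K.1# K.* K.pow (ι u) 3 K.+ C₁ K.* K.pow (ι u) 2 K.+ C₂ K.* ι u K.+ C₃ K.* K.1#)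
            ≡⟨ cong (λ a → (t K.- ι u) K.* (t K.* t K.+ ι b K.* t K.+ ι c) K.+ (a K.* K.pow (ι u) 3 K.+ C₁ K.* K.pow (ι u) 2 K.+ C₂ K.* ι u K.+ C₃ K.* K.1#)) ι-1 ⟨
          (t K.- ι u) K.* (t K.* t K.+ ι b K.* t K.+ ι c) K.+ cubic π (ι u) ∎
          where
          C₁ = ι c₁
          C₂ = ι c₂
          C₃ = ι c₃
          ιb : ι b ≡ C₁ K.+ ι u
          ιb = ι-+ c₁ u
          ιc : ι c ≡ C₂ K.+ ι u K.* (C₁ K.+ ι u)
          ιc = trans (ι-+ c₂ _) (cong (C₂ K.+_) (trans (ι-* u b) (cong (ι u K.*_) ιb)))
        irreducible : Irreducible (b , c)
        irreducible w w-root = none (Any.map (λ { refl → w-root }) (F.∈-elements w))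
        root = irreducible⇒imaginaryRoot b c irreducible
        s = proj₁ root
        s∉F : Imaginary s
        s∉F = proj₁ (proj₂ root)
        s-root : s K.* s K.+ ι b K.* s K.+ ι c ≡ K.0#
        s-root = proj₂ (proj₂ root)

  Bar1⇒imaginaryRoot : ∀ π → Normalized π → Bar1Plane π → HasImaginaryRoot π
  Bar1⇒imaginaryRoot ⟨ _ , c₁ , c₂ , c₃ ⟩ (inj₁ refl) = Bar1⇒imaginaryRoot-⟨1,c₁,c₂,c₃⟩ c₁ c₂ c₃
  Bar1⇒imaginaryRoot ⟨ _ , _ , c₂ , c₃ ⟩ (inj₂ (inj₁ (refl , refl))) = Bar1⇒imaginaryRoot-⟨0,1,c₂,c₃⟩ c₂ c₃
  Bar1⇒imaginaryRoot ⟨ _ , _ , _ , c₃ ⟩ (inj₂ (inj₂ (inj₁ (refl , refl , refl)))) = ⊥-elim ∘ ¬Bar1-⟨0,0,1,c₃⟩ c₃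
  Bar1⇒imaginaryRoot ⟨ _ , _ , _ , _ ⟩ (inj₂ (inj₂ (inj₂ (refl , refl , refl , refl)))) = ⊥-elim ∘ ¬Bar1-⟨0,0,0,1⟩

  SameChord-refl : ∀ s → SameChord s s
  SameChord-refl s X _ = mk⇔ (λ on → on) (λ on → on)

  SameChord-conj : ∀ s → SameChord s (conj s)
  SameChord-conj s X _ = mk⇔ swap swap′
    where
    +K4-comm : ∀ U V → U +K4 V ≡ V +K4 U
    +K4-comm ⟨ a , b , c , d ⟩ ⟨ x , y , z , w ⟩ = ⟨⟩-cong (K.+-comm a x) (K.+-comm b y) (K.+-comm c z) (K.+-comm d w)
    swap : OnChord s X → OnChord (conj s) X
    swap (a , b , X≡) = b , a , trans X≡ (trans (+K4-comm _ _) (cong (λ t → scaleK b (PK (conj s)) +K4 scaleK a (PK t)) (sym (conj-involutive s))))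
    swap′ : OnChord (conj s) X → OnChord s X
    swap′ (a , b , X≡) = b , a , trans X≡ (trans (cong (λ t → scaleK a (PK (conj s)) +K4 scaleK b (PK t)) (conj-involutive s)) (+K4-comm _ _))

  minpoly≡0⇒SameChord : ∀ s t → Chord.minpoly s t ≡ K.0# → SameChord s t
  minpoly≡0⇒SameChord s t minpoly-t≡0 = [ (λ { refl → SameChord-refl s }) , (λ { refl → SameChord-conj s }) ]′ (Chord.minpoly-roots s t minpoly-t≡0)

  ContainsChord⇒∈pencil : ∀ s → Imaginary s → ∀ π → Normalized π → ContainsChord π s → π ∈ Chord.pencil s
  ContainsChord⇒∈pencil s s∉F π π-normalized π⊇chord = Chord.cubic≡0⇒∈pencil s s∉F π π-normalized (ContainsChord⇒cubic≡0 π s s∉F π⊇chord)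

  ContainsChord⇒Bar1 : ∀ s → Imaginary s → ∀ π → Normalized π → ContainsChord π s → Bar1Plane π
  ContainsChord⇒Bar1 s s∉F π π-normalized π⊇chord = Chord.pencil-Bar1 s s∉F (ContainsChord⇒∈pencil s s∉F π π-normalized π⊇chord)

  Bar1⇒not-0-2-3 : ∀ π → Bar1Plane π → ¬ PlaneMeetsC π 0 × ¬ PlaneMeetsC π 2 × ¬ PlaneMeetsC π 3
  Bar1⇒not-0-2-3 π (_ , meets-once) = (λ meets → 1≢0 (HasSize-unique meets-once meets))
                                     , (λ meets → 1≢2 (HasSize-unique meets-once meets))
                                     , (λ meets → 1≢3 (HasSize-unique meets-once meets))
    where
    1≢0 : 1 ≢ 0
    1≢0 ()
    1≢2 : 1 ≢ 2
    1≢2 ()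
    1≢3 : 1 ≢ 3
    1≢3 ()

  planesThroughChord-HasSize : ∀ s → Imaginary s → HasSize Vec4 (λ π → Normalized π × ContainsChord π s) (q ℕ.+ 1)
  planesThroughChord-HasSize s s∉F = Chord.pencil s , Chord.pencil-unique s
    , All.tabulate (λ π∈ → Chord.pencil-normalized s π∈ , Chord.pencil-ContainsChord s π∈)
    , (λ π (π-normalized , π⊇chord) → ContainsChord⇒∈pencil s s∉F π π-normalized π⊇chord)
    , Chord.length-pencil s

  Bar1⇒uniqueChord : ∀ π → Normalized π → Bar1Plane π →
                     ∃[ s ] (Imaginary s × ContainsChord π s × (∀ t → Imaginary t → ContainsChord π t → SameChord s t))
  Bar1⇒uniqueChord π π-normalized bar1 = s , s∉F , Chord.pencil-ContainsChord s π∈pencil , unique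
    where
    root = Bar1⇒imaginaryRoot π π-normalized bar1
    s = proj₁ root
    s∉F : Imaginary s
    s∉F = proj₁ (proj₂ root)
    π∈pencil : π ∈ Chord.pencil s
    π∈pencil = Chord.cubic≡0⇒∈pencil s s∉F π π-normalized (proj₂ (proj₂ root))
    unique : ∀ t → Imaginary t → ContainsChord π t → SameChord s t
    unique t t∉F π⊇chord-t = minpoly≡0⇒SameChord s t (Chord.∈pencil⇒minpoly≡0 s t t∉F π∈pencil (ContainsChord⇒cubic≡0 π t t∉F π⊇chord-t))

  Bar1Planes : List Vec4
  Bar1Planes = concatMap Chord.pencil chords

  private
    pencils-disjoint : AllPairs Disjoint (map Chord.pencil chords)
    pencils-disjoint = AllPairs.map⁺ (AllPairs-mapWithAll (λ {s} {t} s∉F _ separated {π} (π∈s , π∈t) →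
      separated (Chord.∈pencil⇒minpoly≡0 t s s∉F π∈t (Chord.pencil-cubic s π∈s s (Chord.minpoly-s s))))
      (All.tabulate chords-Imaginary) chords-separated)

  Bar1Planes-HasSize : HasSize Vec4 (λ π → Normalized π × Bar1Plane π) ((q C 2) ℕ.* (q ℕ.+ 1))
  Bar1Planes-HasSize = Bar1Planes
    , Unique.concat⁺ (All.map⁺ (All.tabulate (λ _ → Chord.pencil-unique _))) pencils-disjoint
    , All.tabulate (λ π∈ → let s , s∈ , π∈pencil = find (∈-concatMap⁻ Chord.pencil π∈) in
                           Chord.pencil-normalized s π∈pencil , Chord.pencil-Bar1 s (chords-Imaginary s∈) π∈pencil)
    , complete
    , trans (length-concatMap Chord.pencil (q ℕ.+ 1) chords Chord.length-pencil) (cong (ℕ._* (q ℕ.+ 1)) length-chords)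
    where
    complete : ∀ π → Normalized π × Bar1Plane π → π ∈ Bar1Planes
    complete π (π-normalized , bar1) = [ (λ s∈ → into s∈ πs≡0) , (λ s̄∈ → into s̄∈ πs̄≡0) ]′ (chords.cover (∈-imaginaries s∉F))
      where
      root = Bar1⇒imaginaryRoot π π-normalized bar1
      s = proj₁ root
      s∉F : Imaginary s
      s∉F = proj₁ (proj₂ root)
      πs≡0 : cubic π s ≡ K.0#
      πs≡0 = proj₂ (proj₂ root)
      πs̄≡0 : cubic π (conj s) ≡ K.0#
      πs̄≡0 = trans (sym (conj-cubic π s)) (trans (cong conj πs≡0) conj-0)
      into : ∀ {t} → t ∈ chords → cubic π t ≡ K.0# → π ∈ Bar1Planes
      into t∈ πt≡0 = ∈-concatMap⁺ Chord.pencil (lose t∈ (Chord.cubic≡0⇒∈pencil _ (chords-Imaginary t∈) π π-normalized πt≡0))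

  chords-distinct : AllPairs (λ s t → ¬ SameChord s t) chords
  chords-distinct = AllPairs-mapWithAll (λ {s} {t} s∉F _ separated same → separated
      (Chord.∈pencil⇒minpoly≡0 t s s∉F (here refl) (ContainsChord⇒cubic≡0 _ s s∉F λ X X-normalized X∈chord-s →
        Chord.pencil-ContainsChord t (here refl) X X-normalized (Equivalence.to (same X X-normalized) X∈chord-s))))
    (All.tabulate chords-Imaginary) chords-separated

  chords-cover : ∀ t → Imaginary t → Any (SameChord t) chords
  chords-cover t t∉F = [ Any.map (λ { refl → SameChord-refl t }) , Any.map (λ { refl → SameChord-conj t }) ]′
                         (chords.cover (∈-imaginaries t∉F))

open import Data.Nat using (_+_; _*_)

theorem5p3 : (q : ℕ) → IsPrimePower q → 5 ≤ q →
  (F : FiniteField q) (K : FiniteField (q * q)) (E : Embedding F K) →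
  let open TwistedCubic F K E in
  -- no Γ-, 0_C-, 2_C- or 3_C-plane contains an imaginary chord
  (∀ s → Imaginary s → ∀ π → Normalized π → ContainsChord π s →
     ¬ ΓPlane π × ¬ PlaneMeetsC π 0 × ¬ PlaneMeetsC π 2 × ¬ PlaneMeetsC π 3)
  -- exactly q+1 planes through an imaginary chord (a pencil) ...
  × (∀ s → Imaginary s →
       HasSize Vec4 (λ π → Normalized π × ContainsChord π s) (q + 1))
  -- ... and all of them are \overline{1_C}-planes
  × (∀ s → Imaginary s → ∀ π → Normalized π → ContainsChord π s → Bar1Plane π)
  -- every \overline{1_C}-plane contains exactly one imaginary chord
  × (∀ π → Normalized π → Bar1Plane π →
       ∃[ s ] (Imaginary s × ContainsChord π s ×
               (∀ t → Imaginary t → ContainsChord π t → SameChord s t)))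
  -- there are C(q,2)(q+1) \overline{1_C}-planes
  × HasSize Vec4 (λ π → Normalized π × Bar1Plane π) ((q C 2) * (q + 1))
  -- the C(q,2) imaginary chords (axes of the pencils partitioning them)
  × (Σ (List _) λ ss → length ss ≡ q C 2 × All Imaginary ss
       × AllPairs (λ s t → ¬ SameChord s t) ss
       × (∀ t → Imaginary t → Any (SameChord t) ss))
theorem5p3 q (p , k , p-prime , _ , q≡p^k) 5≤q F K E =
    (λ s s∉F π π-normalized π⊇chord → let bar1 = ContainsChord⇒Bar1 s s∉F π π-normalized π⊇chord in
       proj₁ bar1 , Bar1⇒not-0-2-3 π bar1)
  , planesThroughChord-HasSize
  , ContainsChord⇒Bar1
  , Bar1⇒uniqueChord
  , Bar1Planes-HasSize
  , (chords , length-chords , All.tabulate chords-Imaginary , chords-distinct , chords-cover)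
  where open ImaginaryChords p k p-prime q≡p^k (ℕ.≤-trans (s≤s (s≤s z≤n)) 5≤q) F K E
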